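{- Let $\mathbb{K}$ be a field of characteristic zero. The linear species $\mathbb{K}\mathbf{MG}$ of multigraphs, endowed with the insertion of multigraphs as partial composition (and with the one-vertex multigraph without edges as unit), is an operad.
   Context: Species and operads: a (positive) linear species $S$ assigns to every nonempty finite set $V$ a $\mathbb{K}$-vector space $S[V]$ and to every bijection $\sigma:V\to V'$ a linear map $S[\sigma]:S[V]\to S[V']$, functorially. A (symmetric, linear) operad is a linear species $\mathcal{O}$ with, for each singleton $\{v\}$, a unit element in $\mathcal{O}[\{v\}]$, and partial composition maps $\circ_\ast:\mathcal{O}[V_1]\otimes\mathcal{O}[V_2]\to\mathcal{O}[(V_1\setminus\{\ast\})\sqcup V_2]$ for disjoint finite sets $V_1,V_2$ with $\ast\in V_1$, which are equivariant with respect to bijections and satisfy the usual sequential associativity ($(x\circ_{\ast_1}y)\circ_{\ast_2}z=x\circ_{\ast_1}(y\circ_{\ast_2}z)$ when $\ast_2$ is a label of $y$), parallel associativity ($(x\circ_{\ast_1}y)\circ_{\ast_2}z=(x\circ_{\ast_2}z)\circ_{\ast_1}y$ when $\ast_1,\ast_2$ are distinct labels of $x$) and unit axioms. Multigraphs: a multigraph on a finite set $V$ is a finite multiset of unordered pairs $\{u,v\}$ with $u,v\in V$ (called edges; $u=v$ is allowed, giving loops). $\mathbf{MG}[V]$ is the set of multigraphs on $V$, relabelled along bijections, and $\mathbb{K}\mathbf{MG}[V]$ is the vector space with basis $\mathbf{MG}[V]$. Insertion: let $V_1,V_2$ be disjoint finite sets with $\ast\in V_1$, $g_1\in\mathbf{MG}[V_1]$,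 $g_2\in\mathbf{MG}[V_2]$. Each edge of $g_1$ of the form $\{u,\ast\}$ with $u\neq\ast$ contributes one loose end, and each loop $\{\ast,\ast\}$ contributes two loose ends (all loose ends, including those coming from repeated copies of the same edge, are distinguished); let $L$ be the set of loose ends. For each map $f:L\to V_2$, let $g_f\in\mathbf{MG}[(V_1\setminus\{\ast\})\sqcup V_2]$ consist of the edges of $g_1$ not containing $\ast$, the edges of $g_2$, and, for each edge of $g_1$ containing $\ast$, the edge obtained by replacing each occurrence of $\ast$ by $f$ of the corresponding loose end. Then $g_1\circ_\ast g_2=\sum_{f:L\to V_2} g_f$, extended bilinearly. -}

module Defs where

open import Level using (Level; _⊔_) renaming (suc to lsuc)
open import Algebra.Bundles using (CommutativeRing; Semiring)
open import Algebra.Module.Structures using (IsLeftModule)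
import Algebra.Definitions.RawSemiring as RawSemiringDefs
open import Data.Nat using (ℕ; suc; _≟_; _≡ᵇ_)
open import Data.Bool using (Bool; true; false; if_then_else_; _∧_; _∨_)
open import Data.List using (List; []; _∷_; _++_; map; filter; concatMap; foldr)
open import Data.List.Membership.Propositional using (_∈_; mapWith∈)
open import Data.List.Membership.Propositional.Properties
  using (∈-filter⁺; ∈-filter⁻; ∈-++⁺ˡ; ∈-++⁺ʳ)
open import Data.List.Relation.Unary.All as All using (All; []; _∷_)
import Data.List.Relation.Unary.All.Properties as AllP
open import Data.List.Relation.Unary.AllPairs using ([]; _∷_)
open import Data.List.Relation.Unary.Unique.Propositional using (Unique)
import Data.List.Relation.Unary.Unique.Propositional.Properties as UniqueP
open import Data.List.Relation.Binary.Disjoint.Propositional using (Disjoint)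
open import Data.Product using (Σ; _×_; _,_; proj₁; proj₂)
open import Relation.Nullary using (¬_; ¬?; Dec; yes; no)
open import Relation.Binary.PropositionalEquality using (_≡_; _≢_; refl)
open import Relation.Binary.Core using (Rel)

record Field (c ℓ : Level) : Set (lsuc (c ⊔ ℓ)) where
  field
    commutativeRing : CommutativeRing c ℓ
  open CommutativeRing commutativeRing public
  field
    0≉1     : ¬ (0# ≈ 1#)
    inverse : ∀ x → ¬ (x ≈ 0#) → Σ Carrier (λ y → (x * y) ≈ 1#)

CharacteristicZero : ∀ {c ℓ} → Field c ℓ → Set ℓ
CharacteristicZero K =
  ∀ (n : ℕ) → ¬ (RawSemiringDefs._×_ (Semiring.rawSemiring semiring) (suc n) 1# ≈ 0#)
  where open Field K

record FinSet : Set where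
  constructor finSet
  field
    elems  : List ℕ
    unique : Unique elems
open FinSet public

_∈ˢ_ : ℕ → FinSet → Set
v ∈ˢ V = v ∈ elems V

singleton : ℕ → FinSet
singleton v = finSet (v ∷ []) ([] ∷ [])

_∖_ : List ℕ → ℕ → List ℕ
V ∖ ∗ = filter (λ v → ¬? (v ≟ ∗)) V

graft : (V₁ : FinSet) (∗ : ℕ) (V₂ : FinSet) → Disjoint (elems V₁) (elems V₂) → FinSet
graft V₁ ∗ V₂ d =
  finSet (elems V₁ ∖ ∗ ++ elems V₂)
         (UniqueP.++⁺ (UniqueP.filter⁺ (λ v → ¬? (v ≟ ∗)) (unique V₁)) (unique V₂)
            (λ { (p , q) → d (proj₁ (∈-filter⁻ (λ v → ¬? (v ≟ ∗)) p) , q) }))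

record Bij (V W : FinSet) : Set where
  field
    to      : ℕ → ℕ
    from    : ℕ → ℕ
    to∈     : ∀ {x} → x ∈ˢ V → to x ∈ˢ W
    from∈   : ∀ {y} → y ∈ˢ W → from y ∈ˢ V
    from-to : ∀ {x} → x ∈ˢ V → from (to x) ≡ x
    to-from : ∀ {y} → y ∈ˢ W → to (from y) ≡ y
open Bij public

record LinearSpeciesData {c ℓ} (K : Field c ℓ) (a b : Level) : Set (c ⊔ lsuc (a ⊔ b)) where
  open Field K
  field
    S       : FinSet → Set a
    _≈ₛ_    : ∀ {V} → Rel (S V) b
    _+ₛ_    : ∀ {V} → S V → S V → S V
    0ₛ      : ∀ {V} → S V
    -ₛ_     : ∀ {V} → S V → S V
    _·ₛ_    : ∀ {V} → Carrier → S V → S V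
    relabel : ∀ {V W} → Bij V W → S V → S W

module _ {c ℓ a b} {K : Field c ℓ} (sp : LinearSpeciesData K a b) where
  open Field K
  open LinearSpeciesData sp

  record IsLinearSpecies : Set (c ⊔ ℓ ⊔ a ⊔ b) where
    field
      isVectorSpace : ∀ V → IsLeftModule ring (_≈ₛ_ {V}) _+ₛ_ 0ₛ -ₛ_ _·ₛ_
      relabel-cong  : ∀ {V W} (σ : Bij V W) {x y : S V} → x ≈ₛ y → relabel σ x ≈ₛ relabel σ y
      relabel-+     : ∀ {V W} (σ : Bij V W) (x y : S V) →
                      relabel σ (x +ₛ y) ≈ₛ (relabel σ x +ₛ relabel σ y)
      relabel-·     : ∀ {V W} (σ : Bij V W) (k : Carrier) (x : S V) →
                      relabel σ (k ·ₛ x) ≈ₛ (k ·ₛ relabel σ x)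
      relabel-id    : ∀ {V} (σ : Bij V V) → (∀ {v} → v ∈ˢ V → to σ v ≡ v) →
                      ∀ (x : S V) → relabel σ x ≈ₛ x
      relabel-∘     : ∀ {U V W} (σ : Bij U V) (τ : Bij V W) (ρ : Bij U W) →
                      (∀ {u} → u ∈ˢ U → to ρ u ≡ to τ (to σ u)) →
                      ∀ (x : S U) → relabel ρ x ≈ₛ relabel τ (relabel σ x)

  Composition : Set a
  Composition = ∀ {V₁ V₂} (∗ : ℕ) → ∗ ∈ˢ V₁ → (d : Disjoint (elems V₁) (elems V₂)) →
                S V₁ → S V₂ → S (graft V₁ ∗ V₂ d)

  record IsOperad (unit : ∀ v → S (singleton v)) (comp : Composition)
         : Set (c ⊔ ℓ ⊔ a ⊔ b) where
    field
      isLinearSpecies : IsLinearSpecies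
      comp-cong : ∀ {V₁ V₂ ∗} (p : ∗ ∈ˢ V₁) (d : Disjoint (elems V₁) (elems V₂))
                  {x x' : S V₁} {y y' : S V₂} → x ≈ₛ x' → y ≈ₛ y' →
                  comp ∗ p d x y ≈ₛ comp ∗ p d x' y'
      comp-+ˡ   : ∀ {V₁ V₂ ∗} (p : ∗ ∈ˢ V₁) (d : Disjoint (elems V₁) (elems V₂))
                  (x x' : S V₁) (y : S V₂) →
                  comp ∗ p d (x +ₛ x') y ≈ₛ (comp ∗ p d x y +ₛ comp ∗ p d x' y)
      comp-+ʳ   : ∀ {V₁ V₂ ∗} (p : ∗ ∈ˢ V₁) (d : Disjoint (elems V₁) (elems V₂))
                  (x : S V₁) (y y' : S V₂) →
                  comp ∗ p d x (y +ₛ y') ≈ₛ (comp ∗ p d x y +ₛ comp ∗ p d x y')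
      comp-·ˡ   : ∀ {V₁ V₂ ∗} (p : ∗ ∈ˢ V₁) (d : Disjoint (elems V₁) (elems V₂))
                  (k : Carrier) (x : S V₁) (y : S V₂) →
                  comp ∗ p d (k ·ₛ x) y ≈ₛ (k ·ₛ comp ∗ p d x y)
      comp-·ʳ   : ∀ {V₁ V₂ ∗} (p : ∗ ∈ˢ V₁) (d : Disjoint (elems V₁) (elems V₂))
                  (k : Carrier) (x : S V₁) (y : S V₂) →
                  comp ∗ p d x (k ·ₛ y) ≈ₛ (k ·ₛ comp ∗ p d x y)
      comp-equivariant :
        ∀ {V₁ V₂ W₁ W₂ ∗} (p : ∗ ∈ˢ V₁) (d : Disjoint (elems V₁) (elems V₂))
          (σ₁ : Bij V₁ W₁) (σ₂ : Bij V₂ W₂)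
          (p' : to σ₁ ∗ ∈ˢ W₁) (d' : Disjoint (elems W₁) (elems W₂))
          (σ : Bij (graft V₁ ∗ V₂ d) (graft W₁ (to σ₁ ∗) W₂ d')) →
          (∀ {v} → v ∈ˢ V₁ → v ≢ ∗ → to σ v ≡ to σ₁ v) →
          (∀ {v} → v ∈ˢ V₂ → to σ v ≡ to σ₂ v) →
          ∀ (x : S V₁) (y : S V₂) →
          relabel σ (comp ∗ p d x y) ≈ₛ comp (to σ₁ ∗) p' d' (relabel σ₁ x) (relabel σ₂ y)
      -- sequential associativity (both sides compared along the identity of labels)
      assoc-seq :
        ∀ {V₁ V₂ V₃ ∗₁ ∗₂} (p₁ : ∗₁ ∈ˢ V₁) (p₂ : ∗₂ ∈ˢ V₂)
          (d₁₂ : Disjoint (elems V₁) (elems V₂)) (d₂₃ : Disjoint (elems V₂) (elems V₃))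
          (p₂' : ∗₂ ∈ˢ graft V₁ ∗₁ V₂ d₁₂)
          (dL : Disjoint (elems (graft V₁ ∗₁ V₂ d₁₂)) (elems V₃))
          (dR : Disjoint (elems V₁) (elems (graft V₂ ∗₂ V₃ d₂₃)))
          (σ : Bij (graft (graft V₁ ∗₁ V₂ d₁₂) ∗₂ V₃ dL) (graft V₁ ∗₁ (graft V₂ ∗₂ V₃ d₂₃) dR)) →
          (∀ {v} → v ∈ˢ graft (graft V₁ ∗₁ V₂ d₁₂) ∗₂ V₃ dL → to σ v ≡ v) →
          ∀ (x : S V₁) (y : S V₂) (z : S V₃) →
          relabel σ (comp ∗₂ p₂' dL (comp ∗₁ p₁ d₁₂ x y) z) ≈ₛ comp ∗₁ p₁ dR x (comp ∗₂ p₂ d₂₃ y z)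
      assoc-par :
        ∀ {V₁ V₂ V₃ ∗₁ ∗₂} → ∗₁ ≢ ∗₂ → (p₁ : ∗₁ ∈ˢ V₁) (p₂ : ∗₂ ∈ˢ V₁)
          (d₁₂ : Disjoint (elems V₁) (elems V₂)) (d₁₃ : Disjoint (elems V₁) (elems V₃))
          (p₂' : ∗₂ ∈ˢ graft V₁ ∗₁ V₂ d₁₂) (p₁' : ∗₁ ∈ˢ graft V₁ ∗₂ V₃ d₁₃)
          (dL : Disjoint (elems (graft V₁ ∗₁ V₂ d₁₂)) (elems V₃))
          (dR : Disjoint (elems (graft V₁ ∗₂ V₃ d₁₃)) (elems V₂))
          (σ : Bij (graft (graft V₁ ∗₁ V₂ d₁₂) ∗₂ V₃ dL) (graft (graft V₁ ∗₂ V₃ d₁₃) ∗₁ V₂ dR)) →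
          (∀ {v} → v ∈ˢ graft (graft V₁ ∗₁ V₂ d₁₂) ∗₂ V₃ dL → to σ v ≡ v) →
          ∀ (x : S V₁) (y : S V₂) (z : S V₃) →
          relabel σ (comp ∗₂ p₂' dL (comp ∗₁ p₁ d₁₂ x y) z) ≈ₛ comp ∗₁ p₁' dR (comp ∗₂ p₂ d₁₃ x z) y
      unitˡ :
        ∀ {V} (v : ℕ) (p : v ∈ˢ singleton v) (d : Disjoint (v ∷ []) (elems V))
          (σ : Bij (graft (singleton v) v V d) V) →
          (∀ {u} → u ∈ˢ graft (singleton v) v V d → to σ u ≡ u) →
          ∀ (x : S V) → relabel σ (comp v p d (unit v) x) ≈ₛ x
      unitʳ :
        ∀ {V} (∗ v : ℕ) (p : ∗ ∈ˢ V) (d : Disjoint (elems V) (v ∷ []))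
          (σ : Bij (graft V ∗ (singleton v) d) V) →
          to σ v ≡ ∗ → (∀ {u} → u ∈ˢ V → u ≢ ∗ → to σ u ≡ u) →
          ∀ (x : S V) → relabel σ (comp ∗ p d x (unit v)) ≈ₛ x

Edges : Set
Edges = List (ℕ × ℕ)

-- a multigraph on V: a finite list of edges {u,v} with u,v ∈ V
-- (equality of multigraphs is equality of edge multisets, see sameMG)
MG : FinSet → Set
MG V = Σ Edges (All (λ e → proj₁ e ∈ˢ V × proj₂ e ∈ˢ V))

mult : Edges → ℕ → ℕ → ℕ
mult es u v = foldr (λ e n → if ((proj₁ e ≡ᵇ u) ∧ (proj₂ e ≡ᵇ v)) ∨ ((proj₁ e ≡ᵇ v) ∧ (proj₂ e ≡ᵇ u))
                             then suc n else n) 0 es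

sameMG : Edges → Edges → Bool
sameMG g h = foldr (λ e b → (mult g (proj₁ e) (proj₂ e) ≡ᵇ mult h (proj₁ e) (proj₂ e)) ∧ b) true (g ++ h)

relabelMG : ∀ {V W} → Bij V W → MG V → MG W
relabelMG σ (es , ps) =
  map (λ e → to σ (proj₁ e) , to σ (proj₂ e)) es ,
  AllP.map⁺ (All.map (λ { (p , q) → to∈ σ p , to∈ σ q }) ps)

module Insertion (V₁ : FinSet) (∗ : ℕ) (V₂ : FinSet) (d : Disjoint (elems V₁) (elems V₂)) where

  W : FinSet
  W = graft V₁ ∗ V₂ d

  -- possible images of an endpoint a of an edge of g₁ (all of V₂ for a loose end)
  choose′ : (a : ℕ) → a ∈ˢ V₁ → Dec (a ≡ ∗) → List (Σ ℕ (λ b → b ∈ˢ W))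
  choose′ a p (yes _) = mapWith∈ (elems V₂) (λ {b} q → b , ∈-++⁺ʳ (elems V₁ ∖ ∗) q)
  choose′ a p (no a≢∗) = (a , ∈-++⁺ˡ (∈-filter⁺ (λ v → ¬? (v ≟ ∗)) p a≢∗)) ∷ []

  choose : (a : ℕ) → a ∈ˢ V₁ → List (Σ ℕ (λ b → b ∈ˢ W))
  choose a p = choose′ a p (a ≟ ∗)

  -- one result per map f : L → V₂ from the loose ends
  ins : (es : Edges) → All (λ e → proj₁ e ∈ˢ V₁ × proj₂ e ∈ˢ V₁) es → List (MG W)
  ins [] [] = ([] , []) ∷ []
  ins ((a , b) ∷ es) ((pa , pb) ∷ ps) =
    concatMap (λ { (a' , qa) →
      concatMap (λ { (b' , qb) →
        map (λ { (r , rs) → ((a' , b') ∷ r) , ((qa , qb) ∷ rs) }) (ins es ps) })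
        (choose b pb) })
      (choose a pa)

  -- g₁ ∘_∗ g₂ as the list of its terms g_f
  insert : MG V₁ → MG V₂ → List (MG W)
  insert (es₁ , ps₁) (es₂ , ps₂) =
    map (λ { (r , rs) → (r ++ es₂) ,
                        AllP.++⁺ rs (All.map (λ { (p , q) → ∈-++⁺ʳ (elems V₁ ∖ ∗) p ,
                                                            ∈-++⁺ʳ (elems V₁ ∖ ∗) q }) ps₂) })
        (ins es₁ ps₁)

module _ {c ℓ} (K : Field c ℓ) where
  open Field K

  KMG[_] : FinSet → Set c
  KMG[ V ] = List (Carrier × MG V)

  coeff : ∀ {V} → KMG[ V ] → MG V → Carrier
  coeff x g = foldr (λ t acc → (if sameMG (proj₁ (proj₂ t)) (proj₁ g) then proj₁ t else 0#) + acc) 0# x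

  KMG : LinearSpeciesData K c ℓ
  KMG = record
    { S       = KMG[_]
    ; _≈ₛ_    = λ {V} x y → ∀ (g : MG V) → coeff {V} x g ≈ coeff {V} y g
    ; _+ₛ_    = _++_
    ; 0ₛ      = []
    ; -ₛ_     = map (λ t → - proj₁ t , proj₂ t)
    ; _·ₛ_    = λ k → map (λ t → k * proj₁ t , proj₂ t)
    ; relabel = λ σ → map (λ t → proj₁ t , relabelMG σ (proj₂ t))
    }

  unitMG : ∀ v → KMG[ singleton v ]
  unitMG v = (1# , ([] , [])) ∷ []

  insertionMG : Composition KMG
  insertionMG {V₁} {V₂} ∗ _ d x y =
    concatMap (λ s → concatMap (λ t →
        map (λ g → proj₁ s * proj₁ t , g) (Insertion.insert V₁ ∗ V₂ d (proj₂ s) (proj₂ t))) y) x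

-- Unfolding the
-- insertion, the coefficient of h in x ∘∗ y is a sum over the terms of x, the terms of y and the
-- substitutions r of the loose ends of x (every endpoint ∗ replaced by any vertex of V₂) of the product
-- of the weights, counted when r ++ (edges of y) equals h as a multiset of unordered pairs. This count
-- only depends on multigraphs up to that equality, which makes the composition well defined, and every
-- operad axiom becomes an identity between finite sums: reindexing along bijections for equivariance,
-- and for associativity the fact that two successive substitutions are one substitution with composed
-- targets. Sequentially, ∗₁ is sent to (V₂ ∖ ∗₂) ++ V₃; in parallel, the two substitutions act on
-- disjoint vertex sets and therefore commute. No division occurs.

module Submission where

open import Defs
open import Algebra.Bundles using (CommutativeRing)
open import Algebra.Module.Structures using (IsLeftModule)
open import Data.Bool using (Bool; true; false; if_then_else_; T; _∧_; _∨_)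
open import Data.Bool.Properties using (∧-comm; ∨-comm; T-≡; T-∧; T-∨; ⇔→≡)
open import Data.Empty using (⊥-elim)
open import Data.Nat using (ℕ; suc; _≟_; _≡ᵇ_; _≤_; z≤n; s≤s)
  renaming (_+_ to _+ℕ_)
open import Data.Nat.Properties using (≡ᵇ⇒≡; ≡⇒≡ᵇ; suc-injective; ≤-trans; ≤-refl; n≤1+n; +-mono-≤)
  renaming (+-identityʳ to +ℕ-identityʳ)
open import Data.List using (List; []; _∷_; _++_; map; concatMap; foldr; length)
open import Data.List.Properties
  using (map-++; map-∘; map-id; map-cong-local; ++-assoc; ++-identityʳ; concatMap-++; filter-accept; filter-reject)
open import Data.List.Membership.Propositional using (_∈_; _∉_; mapWith∈)
open import Data.List.Membership.Propositional.Properties using (∈-∃++; ∈-++⁺ˡ; ∈-++⁺ʳ; ∈-++⁻; ∈-map⁺; ∈-map⁻)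
open import Data.List.Relation.Unary.Any using (here; there)
open import Data.List.Relation.Unary.All as All using (All; []; _∷_)
import Data.List.Relation.Unary.All.Properties as AllP
open import Data.List.Relation.Unary.AllPairs using ([]; _∷_)
open import Data.List.Relation.Unary.Unique.Propositional using (Unique)
open import Data.List.Relation.Binary.Disjoint.Propositional using (Disjoint)
open import Data.List.Relation.Binary.Permutation.Propositional as Perm using (_↭_; ↭-sym)
open import Data.List.Relation.Binary.Permutation.Propositional.Properties using (shift; ++-comm)
open import Data.Product using (Σ; _×_; _,_; proj₁; proj₂)
open import Data.Sum using (_⊎_; inj₁; inj₂)
open import Function using (id; _∘_; Equivalence; mk⇔)
open import Relation.Nullary using (yes; no; ¬?)
open import Relation.Binary.Core using (Rel)
open import Relation.Binary.PropositionalEquality as P using (_≡_; _≢_)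

module Sums {c ℓ} (R : CommutativeRing c ℓ) where
  open CommutativeRing R
  open import Relation.Binary.Reasoning.Setoid setoid
  open import Algebra.Properties.Ring ring using (-0#≈0#; -‿+-comm)
  open import Algebra.Properties.CommutativeSemigroup +-commutativeSemigroup using (interchange; x∙yz≈y∙xz)

  ∑ : ∀ {a} {A : Set a} → List A → (A → Carrier) → Carrier
  ∑ xs f = foldr (λ x acc → f x + acc) 0# xs

  module _ {a} {A : Set a} where

    ∑-cong : ∀ (xs : List A) {f g : A → Carrier} → (∀ x → f x ≈ g x) → ∑ xs f ≈ ∑ xs g
    ∑-cong [] eq = refl
    ∑-cong (x ∷ xs) eq = +-cong (eq x) (∑-cong xs eq)

    ∑-cong-∈ : ∀ (xs : List A) {f g : A → Carrier} → (∀ {x} → x ∈ xs → f x ≈ g x) → ∑ xs f ≈ ∑ xs g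
    ∑-cong-∈ [] eq = refl
    ∑-cong-∈ (x ∷ xs) eq = +-cong (eq (here P.refl)) (∑-cong-∈ xs (eq ∘ there))

    ∑-++ : ∀ (xs ys : List A) (f : A → Carrier) → ∑ (xs ++ ys) f ≈ ∑ xs f + ∑ ys f
    ∑-++ [] ys f = sym (+-identityˡ _)
    ∑-++ (x ∷ xs) ys f = begin
      f x + ∑ (xs ++ ys) f    ≈⟨ +-congˡ (∑-++ xs ys f) ⟩
      f x + (∑ xs f + ∑ ys f) ≈⟨ sym (+-assoc _ _ _) ⟩
      (f x + ∑ xs f) + ∑ ys f ∎

    ∑-0# : ∀ (xs : List A) → ∑ xs (λ _ → 0#) ≈ 0#
    ∑-0# [] = refl
    ∑-0# (x ∷ xs) = trans (+-identityˡ _) (∑-0# xs)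

    ∑-+ : ∀ (xs : List A) (f g : A → Carrier) → ∑ xs (λ x → f x + g x) ≈ ∑ xs f + ∑ xs g
    ∑-+ [] f g = sym (+-identityˡ _)
    ∑-+ (x ∷ xs) f g = trans (+-congˡ (∑-+ xs f g)) (interchange _ _ _ _)

    *-∑ : ∀ (xs : List A) (k : Carrier) (f : A → Carrier) → k * ∑ xs f ≈ ∑ xs (λ x → k * f x)
    *-∑ [] k f = zeroʳ k
    *-∑ (x ∷ xs) k f = trans (distribˡ _ _ _) (+-congˡ (*-∑ xs k f))

    -‿∑ : ∀ (xs : List A) (f : A → Carrier) → - ∑ xs f ≈ ∑ xs (λ x → - f x)
    -‿∑ [] f = -0#≈0#
    -‿∑ (x ∷ xs) f = trans (sym (-‿+-comm _ _)) (+-congˡ (-‿∑ xs f))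

    ∑-↭ : ∀ {xs ys : List A} (f : A → Carrier) → xs ↭ ys → ∑ xs f ≈ ∑ ys f
    ∑-↭ f Perm.refl = refl
    ∑-↭ f (Perm.prep x p) = +-congˡ (∑-↭ f p)
    ∑-↭ f (Perm.swap x y p) = trans (x∙yz≈y∙xz _ _ _) (+-congˡ (+-congˡ (∑-↭ f p)))
    ∑-↭ f (Perm.trans p q) = trans (∑-↭ f p) (∑-↭ f q)

  ∑-map : ∀ {a b} {A : Set a} {B : Set b} (g : A → B) (xs : List A) (f : B → Carrier) →
          ∑ (map g xs) f ≡ ∑ xs (f ∘ g)
  ∑-map g [] f = P.refl
  ∑-map g (x ∷ xs) f = P.cong (f (g x) +_) (∑-map g xs f)

  ∑-concatMap : ∀ {a b} {A : Set a} {B : Set b} (g : A → List B) (xs : List A) (f : B → Carrier) →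
                ∑ (concatMap g xs) f ≈ ∑ xs (λ x → ∑ (g x) f)
  ∑-concatMap g [] f = refl
  ∑-concatMap g (x ∷ xs) f = trans (∑-++ (g x) (concatMap g xs) f) (+-congˡ (∑-concatMap g xs f))

  ∑-comm : ∀ {a b} {A : Set a} {B : Set b} (xs : List A) (ys : List B) (f : A → B → Carrier) →
           ∑ xs (λ x → ∑ ys (f x)) ≈ ∑ ys (λ y → ∑ xs (λ x → f x y))
  ∑-comm [] ys f = sym (∑-0# ys)
  ∑-comm (x ∷ xs) ys f = trans (+-congˡ (∑-comm xs ys f)) (sym (∑-+ ys _ _))

  *-∑∑ : ∀ {a b} {A : Set a} {B : Set b} (xs : List A) (ys : List B) k (f : A → B → Carrier) →
          k * ∑ xs (λ x → ∑ ys (f x)) ≈ ∑ xs (λ x → ∑ ys (λ y → k * f x y))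
  *-∑∑ xs ys k f = trans (*-∑ xs k _) (∑-cong xs (λ x → *-∑ ys k (f x)))

  when : Bool → Carrier → Carrier
  when b k = if b then k else 0#

  when-cong : ∀ b {k k'} → k ≈ k' → when b k ≈ when b k'
  when-cong true e = e
  when-cong false e = refl

  when-* : ∀ b k k' → when b (k * k') ≈ k * when b k'
  when-* true k k' = refl
  when-* false k k' = sym (zeroʳ k)

  when-‿ : ∀ b k → when b (- k) ≈ - when b k
  when-‿ true k = refl
  when-‿ false k = sym -0#≈0#

module EdgeMultisets where
  open P using (refl; sym; trans; cong; cong₂; subst)

  Edge : Set
  Edge = ℕ × ℕ

  -- the test of Defs.mult, so that mult (e ∷ es) u v unfolds to if matches e u v then … else …
  matches : Edge → ℕ → ℕ → Bool
  matches e u v = ((proj₁ e ≡ᵇ u) ∧ (proj₂ e ≡ᵇ v)) ∨ ((proj₁ e ≡ᵇ v) ∧ (proj₂ e ≡ᵇ u))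

  MultEq : Edges → Edges → Set
  MultEq g h = ∀ u v → mult g u v ≡ mult h u v

  ≡ᵇ-refl : ∀ n → (n ≡ᵇ n) ≡ true
  ≡ᵇ-refl n = Equivalence.to T-≡ (≡⇒≡ᵇ n n refl)

  matches-self : ∀ e → matches e (proj₁ e) (proj₂ e) ≡ true
  matches-self (a , b) rewrite ≡ᵇ-refl a | ≡ᵇ-refl b = refl

  matches-sym : ∀ e u v → matches e u v ≡ matches e v u
  matches-sym e u v = ∨-comm ((proj₁ e ≡ᵇ u) ∧ (proj₂ e ≡ᵇ v)) _

  matches-flip : ∀ a b u v → matches (a , b) u v ≡ matches (b , a) u v
  matches-flip a b u v rewrite ∧-comm (a ≡ᵇ u) (b ≡ᵇ v) | ∧-comm (a ≡ᵇ v) (b ≡ᵇ u) =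
    ∨-comm ((b ≡ᵇ v) ∧ (a ≡ᵇ u)) _

  ≡ᵇ-∧-≡ᵇ⇒≡ : ∀ a b x y → T ((a ≡ᵇ x) ∧ (b ≡ᵇ y)) → (a , b) ≡ (x , y)
  ≡ᵇ-∧-≡ᵇ⇒≡ a b x y t = let (p , q) = Equivalence.to T-∧ t in cong₂ _,_ (≡ᵇ⇒≡ a x p) (≡ᵇ⇒≡ b y q)

  matches⇒≡ : ∀ e u v → matches e u v ≡ true → e ≡ (u , v) ⊎ e ≡ (v , u)
  matches⇒≡ (a , b) u v m with Equivalence.to T-∨ (Equivalence.from T-≡ m)
  ... | inj₁ t = inj₁ (≡ᵇ-∧-≡ᵇ⇒≡ a b u v t)
  ... | inj₂ t = inj₂ (≡ᵇ-∧-≡ᵇ⇒≡ a b v u t)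

  mult-sym : ∀ es u v → mult es u v ≡ mult es v u
  mult-sym [] u v = refl
  mult-sym (e ∷ es) u v rewrite matches-sym e u v with matches e v u
  ... | true = cong suc (mult-sym es u v)
  ... | false = mult-sym es u v

  matches⇒mult≡ : ∀ e u v → matches e u v ≡ true → ∀ es → mult es u v ≡ mult es (proj₁ e) (proj₂ e)
  matches⇒mult≡ e u v m es with matches⇒≡ e u v m
  ... | inj₁ refl = refl
  ... | inj₂ refl = mult-sym es u v

  mult≡0⊎matching : ∀ es u v → mult es u v ≡ 0 ⊎ Σ Edge (λ e → e ∈ es × matches e u v ≡ true)
  mult≡0⊎matching [] u v = inj₁ refl
  mult≡0⊎matching (e ∷ es) u v with matches e u v in m
  ... | true = inj₂ (e , here refl , m)
  ... | false with mult≡0⊎matching es u v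
  ...   | inj₁ z = inj₁ z
  ...   | inj₂ (f , f∈ , m′) = inj₂ (f , there f∈ , m′)

  agreeOn : Edges → Edges → Edges → Bool
  agreeOn g h L = foldr (λ e b → (mult g (proj₁ e) (proj₂ e) ≡ᵇ mult h (proj₁ e) (proj₂ e)) ∧ b) true L

  agreeOn-sound : ∀ g h L → T (agreeOn g h L) → ∀ {e} → e ∈ L →
                  mult g (proj₁ e) (proj₂ e) ≡ mult h (proj₁ e) (proj₂ e)
  agreeOn-sound g h (f ∷ L) t (here refl) = ≡ᵇ⇒≡ _ _ (proj₁ (Equivalence.to T-∧ t))
  agreeOn-sound g h (f ∷ L) t (there e∈) = agreeOn-sound g h L (proj₂ (Equivalence.to T-∧ t)) e∈

  agreeOn-complete : ∀ g h → MultEq g h → ∀ L → T (agreeOn g h L)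
  agreeOn-complete g h m [] = _
  agreeOn-complete g h m (f ∷ L) =
    Equivalence.from T-∧ (≡⇒≡ᵇ _ _ (m (proj₁ f) (proj₂ f)) , agreeOn-complete g h m L)

  sameMG⇒mult≡ : ∀ g h → sameMG g h ≡ true → ∀ {e u v} → e ∈ g ++ h → matches e u v ≡ true →
                 mult g u v ≡ mult h u v
  sameMG⇒mult≡ g h eq {e} {u} {v} e∈ m = trans (matches⇒mult≡ e u v m g)
    (trans (agreeOn-sound g h (g ++ h) (Equivalence.from T-≡ eq) e∈) (sym (matches⇒mult≡ e u v m h)))

  -- An edge {u,v} occurring in neither g nor h has multiplicity 0 in both.
  sameMG⇒MultEq : ∀ g h → sameMG g h ≡ true → MultEq g h
  sameMG⇒MultEq g h eq u v with mult≡0⊎matching g u v | mult≡0⊎matching h u v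
  ... | inj₂ (e , e∈ , m) | _                  = sameMG⇒mult≡ g h eq (∈-++⁺ˡ e∈) m
  ... | inj₁ _           | inj₂ (e , e∈ , m) = sameMG⇒mult≡ g h eq (∈-++⁺ʳ g e∈) m
  ... | inj₁ z₁          | inj₁ z₂           = trans z₁ (sym z₂)

  MultEq⇒sameMG : ∀ g h → MultEq g h → sameMG g h ≡ true
  MultEq⇒sameMG g h m = Equivalence.to T-≡ (agreeOn-complete g h m (g ++ h))

  infix 4 _≋_
  data _≋_ : Edges → Edges → Set where
    ≋-refl  : ∀ {es} → es ≋ es
    ≋-sym   : ∀ {es fs} → es ≋ fs → fs ≋ es
    ≋-trans : ∀ {es fs gs} → es ≋ fs → fs ≋ gs → es ≋ gs
    ≋-prep  : ∀ e {es fs} → es ≋ fs → (e ∷ es) ≋ (e ∷ fs)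
    ≋-swap  : ∀ e f es → (e ∷ f ∷ es) ≋ (f ∷ e ∷ es)
    ≋-flip  : ∀ a b es → ((a , b) ∷ es) ≋ ((b , a) ∷ es)

  ≋⇒MultEq : ∀ {es fs} → es ≋ fs → MultEq es fs
  ≋⇒MultEq ≋-refl u v = refl
  ≋⇒MultEq (≋-sym p) u v = sym (≋⇒MultEq p u v)
  ≋⇒MultEq (≋-trans p q) u v = trans (≋⇒MultEq p u v) (≋⇒MultEq q u v)
  ≋⇒MultEq (≋-prep e p) u v with matches e u v
  ... | true = cong suc (≋⇒MultEq p u v)
  ... | false = ≋⇒MultEq p u v
  ≋⇒MultEq (≋-swap e f es) u v with matches e u v | matches f u v
  ... | true  | true  = refl
  ... | true  | false = refl
  ... | false | true  = refl
  ... | false | false = refl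
  ≋⇒MultEq (≋-flip a b es) u v rewrite matches-flip a b u v = refl

  ↭⇒≋ : ∀ {es fs} → es ↭ fs → es ≋ fs
  ↭⇒≋ Perm.refl = ≋-refl
  ↭⇒≋ (Perm.prep x p) = ≋-prep x (↭⇒≋ p)
  ↭⇒≋ (Perm.swap x y p) = ≋-trans (≋-swap x y _) (≋-prep y (≋-prep x (↭⇒≋ p)))
  ↭⇒≋ (Perm.trans p q) = ≋-trans (↭⇒≋ p) (↭⇒≋ q)

  MultEq-cancel : ∀ e es fs → MultEq (e ∷ es) (e ∷ fs) → MultEq es fs
  MultEq-cancel e es fs m u v with matches e u v | m u v
  ... | true  | q = suc-injective q
  ... | false | q = q

  matches⇒≋ : ∀ f e es → matches f (proj₁ e) (proj₂ e) ≡ true → (f ∷ es) ≋ (e ∷ es)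
  matches⇒≋ f e es m with matches⇒≡ f (proj₁ e) (proj₂ e) m
  ... | inj₁ refl = ≋-refl
  ... | inj₂ refl = ≋-flip (proj₂ e) (proj₁ e) es

  mult-self : ∀ e es → mult (e ∷ es) (proj₁ e) (proj₂ e) ≡ suc (mult es (proj₁ e) (proj₂ e))
  mult-self e es rewrite matches-self e = refl

  MultEq⇒≋ : ∀ es fs → MultEq es fs → es ≋ fs
  MultEq⇒≋ [] [] m = ≋-refl
  MultEq⇒≋ [] (f ∷ fs) m with () ← trans (m (proj₁ f) (proj₂ f)) (mult-self f fs)
  MultEq⇒≋ (e ∷ es) fs m with mult≡0⊎matching fs (proj₁ e) (proj₂ e)
  ... | inj₁ z with () ← trans (sym (mult-self e es)) (trans (m (proj₁ e) (proj₂ e)) z)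
  ... | inj₂ (f , f∈ , mf) with ∈-∃++ f∈
  ... | fs₁ , fs₂ , refl = ≋-sym (≋-trans fs≋e∷rest (≋-prep e (≋-sym es≋rest)))
    where
    fs≋e∷rest : (fs₁ ++ f ∷ fs₂) ≋ (e ∷ (fs₁ ++ fs₂))
    fs≋e∷rest = ≋-trans (↭⇒≋ (shift f fs₁ fs₂)) (matches⇒≋ f e (fs₁ ++ fs₂) mf)
    es≋rest : es ≋ (fs₁ ++ fs₂)
    es≋rest = MultEq⇒≋ es (fs₁ ++ fs₂)
      (MultEq-cancel e es (fs₁ ++ fs₂) (λ u v → trans (m u v) (≋⇒MultEq fs≋e∷rest u v)))

  sameMG⇒≋ : ∀ {es fs} → sameMG es fs ≡ true → es ≋ fs
  sameMG⇒≋ {es} {fs} eq = MultEq⇒≋ es fs (sameMG⇒MultEq es fs eq)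

  ≋⇒sameMG : ∀ {es fs} → es ≋ fs → sameMG es fs ≡ true
  ≋⇒sameMG {es} {fs} p = MultEq⇒sameMG es fs (≋⇒MultEq p)

  sameMG-respˡ : ∀ {es es′} → es ≋ es′ → ∀ h → sameMG es h ≡ sameMG es′ h
  sameMG-respˡ {es} {es′} p h = ⇔→≡ {z = true} (mk⇔
    (λ e → ≋⇒sameMG (≋-trans (≋-sym p) (sameMG⇒≋ {es} {h} e)))
    (λ e → ≋⇒sameMG (≋-trans p (sameMG⇒≋ {es′} {h} e))))

  sameMG-respʳ : ∀ {es es′} → es ≋ es′ → ∀ h → sameMG h es ≡ sameMG h es′
  sameMG-respʳ {es} {es′} p h = ⇔→≡ {z = true} (mk⇔
    (λ e → ≋⇒sameMG (≋-trans (sameMG⇒≋ {h} {es} e) p))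
    (λ e → ≋⇒sameMG (≋-trans (sameMG⇒≋ {h} {es′} e) (≋-sym p))))

  ≋-++ʳ : ∀ {es fs} (gs : Edges) → es ≋ fs → (es ++ gs) ≋ (fs ++ gs)
  ≋-++ʳ gs ≋-refl = ≋-refl
  ≋-++ʳ gs (≋-sym p) = ≋-sym (≋-++ʳ gs p)
  ≋-++ʳ gs (≋-trans p q) = ≋-trans (≋-++ʳ gs p) (≋-++ʳ gs q)
  ≋-++ʳ gs (≋-prep e p) = ≋-prep e (≋-++ʳ gs p)
  ≋-++ʳ gs (≋-swap e f es) = ≋-swap e f (es ++ gs)
  ≋-++ʳ gs (≋-flip a b es) = ≋-flip a b (es ++ gs)

  ≋-++ˡ : ∀ {es fs} (gs : Edges) → es ≋ fs → (gs ++ es) ≋ (gs ++ fs)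
  ≋-++ˡ [] p = p
  ≋-++ˡ (e ∷ gs) p = ≋-prep e (≋-++ˡ gs p)

  EdgesIn : ∀ {p} → (ℕ → Set p) → Edges → Set p
  EdgesIn P = All (λ e → P (proj₁ e) × P (proj₂ e))

  relabelEdges : (ℕ → ℕ) → Edges → Edges
  relabelEdges f = map (λ e → f (proj₁ e) , f (proj₂ e))

  ≋-relabel : ∀ {es fs} (f : ℕ → ℕ) → es ≋ fs → relabelEdges f es ≋ relabelEdges f fs
  ≋-relabel f ≋-refl = ≋-refl
  ≋-relabel f (≋-sym p) = ≋-sym (≋-relabel f p)
  ≋-relabel f (≋-trans p q) = ≋-trans (≋-relabel f p) (≋-relabel f q)
  ≋-relabel f (≋-prep e p) = ≋-prep _ (≋-relabel f p)
  ≋-relabel f (≋-swap e g es) = ≋-swap _ _ _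
  ≋-relabel f (≋-flip a b es) = ≋-flip _ _ _

  relabelEdges-cong : ∀ {p} {P : ℕ → Set p} {f g : ℕ → ℕ} → (∀ {v} → P v → f v ≡ g v) →
                      ∀ {es} → EdgesIn P es → relabelEdges f es ≡ relabelEdges g es
  relabelEdges-cong f≗g ps = map-cong-local (All.map (λ (pa , pb) → cong₂ _,_ (f≗g pa) (f≗g pb)) ps)

  relabelEdges-id : ∀ {p} {P : ℕ → Set p} {f : ℕ → ℕ} → (∀ {v} → P v → f v ≡ v) →
                    ∀ {es} → EdgesIn P es → relabelEdges f es ≡ es
  relabelEdges-id f≗id {es} ps = trans (relabelEdges-cong f≗id ps) (map-id es)

  relabelEdges-∘ : ∀ (f g : ℕ → ℕ) es → relabelEdges g (relabelEdges f es) ≡ relabelEdges (g ∘ f) es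
  relabelEdges-∘ f g es = sym (map-∘ es)

  sameMG-relabel : ∀ {p q} {P : ℕ → Set p} {Q : ℕ → Set q} (f g : ℕ → ℕ) →
                   (∀ {v} → P v → g (f v) ≡ v) → (∀ {w} → Q w → f (g w) ≡ w) →
                   ∀ {es fs} → EdgesIn P es → EdgesIn Q fs →
                   sameMG (relabelEdges f es) fs ≡ sameMG es (relabelEdges g fs)
  sameMG-relabel f g gf fg {es} {fs} ps qs = ⇔→≡ {z = true} (mk⇔
    (λ e → ≋⇒sameMG (subst (_≋ relabelEdges g fs) (round-trip gf ps)
                       (≋-relabel g (sameMG⇒≋ {relabelEdges f es} {fs} e))))
    (λ e → ≋⇒sameMG (subst (relabelEdges f es ≋_) (round-trip fg qs)
                       (≋-relabel f (sameMG⇒≋ {es} {relabelEdges g fs} e)))))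
    where
    round-trip : ∀ {r} {R : ℕ → Set r} {h k : ℕ → ℕ} → (∀ {v} → R v → k (h v) ≡ v) →
                 ∀ {gs} → EdgesIn R gs → relabelEdges k (relabelEdges h gs) ≡ gs
    round-trip {h = h} {k} kh {gs} rs = trans (relabelEdges-∘ h k gs) (relabelEdges-id kh rs)

open EdgeMultisets

substitutions : (ℕ → List ℕ) → Edges → List Edges
substitutions o [] = [] ∷ []
substitutions o ((a , b) ∷ es) =
  concatMap (λ a′ → concatMap (λ b′ → map ((a′ , b′) ∷_) (substitutions o es)) (o b)) (o a)

substitutions-relabel : ∀ (o : ℕ → List ℕ) f es → substitutions o (relabelEdges f es) ≡ substitutions (o ∘ f) es
substitutions-relabel o f [] = P.refl
substitutions-relabel o f ((a , b) ∷ es) rewrite substitutions-relabel o f es = P.refl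

module SubstitutionSums {c ℓ} (R : CommutativeRing c ℓ) where
  open CommutativeRing R
  open Sums R
  open import Relation.Binary.Reasoning.Setoid setoid

  ∑-substitutions-∷ : ∀ o a b es (φ : Edges → Carrier) →
    ∑ (substitutions o ((a , b) ∷ es)) φ ≈
    ∑ (o a) (λ a′ → ∑ (o b) (λ b′ → ∑ (substitutions o es) (λ r → φ ((a′ , b′) ∷ r))))
  ∑-substitutions-∷ o a b es φ = begin
    ∑ (substitutions o ((a , b) ∷ es)) φ
      ≈⟨ ∑-concatMap _ (o a) φ ⟩
    ∑ (o a) (λ a′ → ∑ (concatMap (λ b′ → map ((a′ , b′) ∷_) (substitutions o es)) (o b)) φ)
      ≈⟨ ∑-cong (o a) (λ a′ → ∑-concatMap _ (o b) φ) ⟩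
    ∑ (o a) (λ a′ → ∑ (o b) (λ b′ → ∑ (map ((a′ , b′) ∷_) (substitutions o es)) φ))
      ≈⟨ ∑-cong (o a) (λ a′ → ∑-cong (o b) (λ b′ → reflexive (∑-map ((a′ , b′) ∷_) (substitutions o es) φ))) ⟩
    ∑ (o a) (λ a′ → ∑ (o b) (λ b′ → ∑ (substitutions o es) (λ r → φ ((a′ , b′) ∷ r)))) ∎

  ∑-substitutions-++ : ∀ o es fs (φ : Edges → Carrier) →
    ∑ (substitutions o (es ++ fs)) φ ≈ ∑ (substitutions o es) (λ r → ∑ (substitutions o fs) (λ q → φ (r ++ q)))
  ∑-substitutions-++ o [] fs φ = sym (+-identityʳ _)
  ∑-substitutions-++ o ((a , b) ∷ es) fs φ = begin
    ∑ (substitutions o ((a , b) ∷ es ++ fs)) φ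
      ≈⟨ ∑-substitutions-∷ o a b (es ++ fs) φ ⟩
    ∑ (o a) (λ a′ → ∑ (o b) (λ b′ → ∑ (substitutions o (es ++ fs)) (λ q → φ ((a′ , b′) ∷ q))))
      ≈⟨ ∑-cong (o a) (λ a′ → ∑-cong (o b) (λ b′ → ∑-substitutions-++ o es fs _)) ⟩
    ∑ (o a) (λ a′ → ∑ (o b) (λ b′ → ∑ (substitutions o es) (λ r →
      ∑ (substitutions o fs) (λ q → φ ((a′ , b′) ∷ r ++ q)))))
      ≈⟨ sym (∑-substitutions-∷ o a b es _) ⟩
    ∑ (substitutions o ((a , b) ∷ es)) (λ r → ∑ (substitutions o fs) (λ q → φ (r ++ q))) ∎

  ∑-substitutions-relabel : ∀ o (f : ℕ → ℕ) es (φ : Edges → Carrier) →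
    ∑ (substitutions o es) (φ ∘ relabelEdges f) ≈ ∑ (substitutions (map f ∘ o) es) φ
  ∑-substitutions-relabel o f [] φ = refl
  ∑-substitutions-relabel o f ((a , b) ∷ es) φ = begin
    ∑ (substitutions o ((a , b) ∷ es)) (φ ∘ relabelEdges f)
      ≈⟨ ∑-substitutions-∷ o a b es _ ⟩
    ∑ (o a) (λ a′ → ∑ (o b) (λ b′ → ∑ (substitutions o es) (λ r → φ ((f a′ , f b′) ∷ relabelEdges f r))))
      ≈⟨ ∑-cong (o a) (λ a′ → ∑-cong (o b) (λ b′ → ∑-substitutions-relabel o f es _)) ⟩
    ∑ (o a) (λ a′ → ∑ (o b) (λ b′ → ∑ (substitutions (map f ∘ o) es) (λ r → φ ((f a′ , f b′) ∷ r))))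
      ≈⟨ ∑-cong (o a) (λ a′ → reflexive (P.sym (∑-map f (o b) _))) ⟩
    ∑ (o a) (λ a′ → ∑ (map f (o b)) (λ b′ → ∑ (substitutions (map f ∘ o) es) (λ r → φ ((f a′ , b′) ∷ r))))
      ≈⟨ reflexive (P.sym (∑-map f (o a) _)) ⟩
    ∑ (map f (o a)) (λ a′ → ∑ (map f (o b)) (λ b′ → ∑ (substitutions (map f ∘ o) es) (λ r → φ ((a′ , b′) ∷ r))))
      ≈⟨ sym (∑-substitutions-∷ (map f ∘ o) a b es φ) ⟩
    ∑ (substitutions (map f ∘ o) ((a , b) ∷ es)) φ ∎

  module _ {p} {Pr : ℕ → Set p} where

    ∑-substitutions-cong : ∀ (o o′ : ℕ → List ℕ) →
      (∀ {x} → Pr x → ∀ (ψ : ℕ → Carrier) → ∑ (o x) ψ ≈ ∑ (o′ x) ψ) →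
      ∀ {es} → EdgesIn Pr es → ∀ (φ : Edges → Carrier) → ∑ (substitutions o es) φ ≈ ∑ (substitutions o′ es) φ
    ∑-substitutions-cong o o′ o≈o′ [] φ = refl
    ∑-substitutions-cong o o′ o≈o′ {(a , b) ∷ es} ((pa , pb) ∷ ps) φ = begin
      ∑ (substitutions o ((a , b) ∷ es)) φ
        ≈⟨ ∑-substitutions-∷ o a b es φ ⟩
      ∑ (o a) (λ a′ → ∑ (o b) (λ b′ → ∑ (substitutions o es) (λ r → φ ((a′ , b′) ∷ r))))
        ≈⟨ ∑-cong (o a) (λ a′ → ∑-cong (o b) (λ b′ → ∑-substitutions-cong o o′ o≈o′ ps _)) ⟩
      ∑ (o a) (λ a′ → ∑ (o b) (λ b′ → ∑ (substitutions o′ es) (λ r → φ ((a′ , b′) ∷ r))))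
        ≈⟨ ∑-cong (o a) (λ a′ → o≈o′ pb _) ⟩
      ∑ (o a) (λ a′ → ∑ (o′ b) (λ b′ → ∑ (substitutions o′ es) (λ r → φ ((a′ , b′) ∷ r))))
        ≈⟨ o≈o′ pa _ ⟩
      ∑ (o′ a) (λ a′ → ∑ (o′ b) (λ b′ → ∑ (substitutions o′ es) (λ r → φ ((a′ , b′) ∷ r))))
        ≈⟨ sym (∑-substitutions-∷ o′ a b es φ) ⟩
      ∑ (substitutions o′ ((a , b) ∷ es)) φ ∎

    ∑-substitutions-point : ∀ (o : ℕ → List ℕ) (g : ℕ → ℕ) →
      (∀ {x} → Pr x → ∀ (ψ : ℕ → Carrier) → ∑ (o x) ψ ≈ ψ (g x)) →
      ∀ {es} → EdgesIn Pr es → ∀ (φ : Edges → Carrier) → ∑ (substitutions o es) φ ≈ φ (relabelEdges g es)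
    ∑-substitutions-point o g o≈g [] φ = +-identityʳ _
    ∑-substitutions-point o g o≈g {(a , b) ∷ es} ((pa , pb) ∷ ps) φ = begin
      ∑ (substitutions o ((a , b) ∷ es)) φ
        ≈⟨ ∑-substitutions-∷ o a b es φ ⟩
      ∑ (o a) (λ a′ → ∑ (o b) (λ b′ → ∑ (substitutions o es) (λ r → φ ((a′ , b′) ∷ r))))
        ≈⟨ ∑-cong (o a) (λ a′ → ∑-cong (o b) (λ b′ → ∑-substitutions-point o g o≈g ps _)) ⟩
      ∑ (o a) (λ a′ → ∑ (o b) (λ b′ → φ ((a′ , b′) ∷ relabelEdges g es)))
        ≈⟨ ∑-cong (o a) (λ a′ → o≈g pb _) ⟩
      ∑ (o a) (λ a′ → φ ((a′ , g b) ∷ relabelEdges g es))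
        ≈⟨ o≈g pa _ ⟩
      φ (relabelEdges g ((a , b) ∷ es)) ∎

    ∑-substitutions-∘ : ∀ (o₁ o₂ o₃ : ℕ → List ℕ) →
      (∀ {x} → Pr x → ∀ (ψ : ℕ → Carrier) → ∑ (o₁ x) (λ y → ∑ (o₂ y) ψ) ≈ ∑ (o₃ x) ψ) →
      ∀ {es} → EdgesIn Pr es → ∀ (φ : Edges → Carrier) →
      ∑ (substitutions o₁ es) (λ r → ∑ (substitutions o₂ r) φ) ≈ ∑ (substitutions o₃ es) φ
    ∑-substitutions-∘ o₁ o₂ o₃ o₁₂≈o₃ [] φ = +-identityʳ _
    ∑-substitutions-∘ o₁ o₂ o₃ o₁₂≈o₃ {(a , b) ∷ es} ((pa , pb) ∷ ps) φ = begin
      ∑ (substitutions o₁ ((a , b) ∷ es)) (λ r → ∑ (substitutions o₂ r) φ)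
        ≈⟨ ∑-substitutions-∷ o₁ a b es _ ⟩
      ∑ (o₁ a) (λ a′ → ∑ (o₁ b) (λ b′ → ∑ (substitutions o₁ es) (λ r →
        ∑ (substitutions o₂ ((a′ , b′) ∷ r)) φ)))
        ≈⟨ ∑-cong (o₁ a) (λ a′ → ∑-cong (o₁ b) (λ b′ → ∑-cong (substitutions o₁ es) (λ r →
             ∑-substitutions-∷ o₂ a′ b′ r φ))) ⟩
      ∑ (o₁ a) (λ a′ → ∑ (o₁ b) (λ b′ → ∑ (substitutions o₁ es) (λ r →
        ∑ (o₂ a′) (λ a″ → ∑ (o₂ b′) (λ b″ → ∑ (substitutions o₂ r) (λ q → φ ((a″ , b″) ∷ q)))))))
        ≈⟨ ∑-cong (o₁ a) (λ a′ → ∑-cong (o₁ b) (λ b′ → ∑-comm (substitutions o₁ es) (o₂ a′) _)) ⟩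
      ∑ (o₁ a) (λ a′ → ∑ (o₁ b) (λ b′ → ∑ (o₂ a′) (λ a″ → ∑ (substitutions o₁ es) (λ r →
        ∑ (o₂ b′) (λ b″ → ∑ (substitutions o₂ r) (λ q → φ ((a″ , b″) ∷ q)))))))
        ≈⟨ ∑-cong (o₁ a) (λ a′ → ∑-cong (o₁ b) (λ b′ → ∑-cong (o₂ a′) (λ a″ →
             ∑-comm (substitutions o₁ es) (o₂ b′) _))) ⟩
      ∑ (o₁ a) (λ a′ → ∑ (o₁ b) (λ b′ → ∑ (o₂ a′) (λ a″ → ∑ (o₂ b′) (λ b″ →
        ∑ (substitutions o₁ es) (λ r → ∑ (substitutions o₂ r) (λ q → φ ((a″ , b″) ∷ q)))))))
        ≈⟨ ∑-cong (o₁ a) (λ a′ → ∑-cong (o₁ b) (λ b′ → ∑-cong (o₂ a′) (λ a″ → ∑-cong (o₂ b′) (λ b″ →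
             ∑-substitutions-∘ o₁ o₂ o₃ o₁₂≈o₃ ps _)))) ⟩
      ∑ (o₁ a) (λ a′ → ∑ (o₁ b) (λ b′ → ∑ (o₂ a′) (λ a″ → ∑ (o₂ b′) (λ b″ →
        ∑ (substitutions o₃ es) (λ q → φ ((a″ , b″) ∷ q))))))
        ≈⟨ ∑-cong (o₁ a) (λ a′ → ∑-comm (o₁ b) (o₂ a′) _) ⟩
      ∑ (o₁ a) (λ a′ → ∑ (o₂ a′) (λ a″ → ∑ (o₁ b) (λ b′ → ∑ (o₂ b′) (λ b″ →
        ∑ (substitutions o₃ es) (λ q → φ ((a″ , b″) ∷ q))))))
        ≈⟨ ∑-cong (o₁ a) (λ a′ → ∑-cong (o₂ a′) (λ a″ → o₁₂≈o₃ pb _)) ⟩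
      ∑ (o₁ a) (λ a′ → ∑ (o₂ a′) (λ a″ → ∑ (o₃ b) (λ b″ → ∑ (substitutions o₃ es) (λ q → φ ((a″ , b″) ∷ q)))))
        ≈⟨ o₁₂≈o₃ pa _ ⟩
      ∑ (o₃ a) (λ a″ → ∑ (o₃ b) (λ b″ → ∑ (substitutions o₃ es) (λ q → φ ((a″ , b″) ∷ q))))
        ≈⟨ sym (∑-substitutions-∷ o₃ a b es φ) ⟩
      ∑ (substitutions o₃ ((a , b) ∷ es)) φ ∎

  ∑-substitutions-≋ : ∀ (o : ℕ → List ℕ) {es fs} → es ≋ fs → ∀ (φ : Edges → Carrier) →
    (∀ {r r′} → r ≋ r′ → φ r ≈ φ r′) → ∑ (substitutions o es) φ ≈ ∑ (substitutions o fs) φ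
  ∑-substitutions-≋ o ≋-refl φ φ-inv = refl
  ∑-substitutions-≋ o (≋-sym p) φ φ-inv = sym (∑-substitutions-≋ o p φ φ-inv)
  ∑-substitutions-≋ o (≋-trans p q) φ φ-inv = trans (∑-substitutions-≋ o p φ φ-inv) (∑-substitutions-≋ o q φ φ-inv)
  ∑-substitutions-≋ o (≋-prep (a , b) {es} {fs} p) φ φ-inv = begin
    ∑ (substitutions o ((a , b) ∷ es)) φ
      ≈⟨ ∑-substitutions-∷ o a b es φ ⟩
    ∑ (o a) (λ a′ → ∑ (o b) (λ b′ → ∑ (substitutions o es) (λ r → φ ((a′ , b′) ∷ r))))
      ≈⟨ ∑-cong (o a) (λ a′ → ∑-cong (o b) (λ b′ → ∑-substitutions-≋ o p _ (φ-inv ∘ ≋-prep _))) ⟩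
    ∑ (o a) (λ a′ → ∑ (o b) (λ b′ → ∑ (substitutions o fs) (λ r → φ ((a′ , b′) ∷ r))))
      ≈⟨ sym (∑-substitutions-∷ o a b fs φ) ⟩
    ∑ (substitutions o ((a , b) ∷ fs)) φ ∎
  ∑-substitutions-≋ o (≋-swap (a , b) (c , d) es) φ φ-inv = begin
    ∑ (substitutions o ((a , b) ∷ (c , d) ∷ es)) φ
      ≈⟨ ∑-substitutions-∷ o a b ((c , d) ∷ es) φ ⟩
    ∑ (o a) (λ a′ → ∑ (o b) (λ b′ → ∑ (substitutions o ((c , d) ∷ es)) (λ r → φ ((a′ , b′) ∷ r))))
      ≈⟨ ∑-cong (o a) (λ a′ → ∑-cong (o b) (λ b′ → ∑-substitutions-∷ o c d es _)) ⟩
    ∑ (o a) (λ a′ → ∑ (o b) (λ b′ → ∑ (o c) (λ c′ → ∑ (o d) (λ d′ → ∑ (substitutions o es) (λ r →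
      φ ((a′ , b′) ∷ (c′ , d′) ∷ r))))))
      ≈⟨ ∑-cong (o a) (λ a′ → ∑-cong (o b) (λ b′ → ∑-cong (o c) (λ c′ → ∑-cong (o d) (λ d′ →
           ∑-cong (substitutions o es) (λ r → φ-inv (≋-swap _ _ r)))))) ⟩
    ∑ (o a) (λ a′ → ∑ (o b) (λ b′ → ∑ (o c) (λ c′ → ∑ (o d) (λ d′ → ∑ (substitutions o es) (λ r →
      φ ((c′ , d′) ∷ (a′ , b′) ∷ r))))))
      ≈⟨ ∑-cong (o a) (λ a′ → trans (∑-comm (o b) (o c) _) (∑-cong (o c) (λ c′ → ∑-comm (o b) (o d) _))) ⟩
    ∑ (o a) (λ a′ → ∑ (o c) (λ c′ → ∑ (o d) (λ d′ → ∑ (o b) (λ b′ → ∑ (substitutions o es) (λ r →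
      φ ((c′ , d′) ∷ (a′ , b′) ∷ r))))))
      ≈⟨ trans (∑-comm (o a) (o c) _) (∑-cong (o c) (λ c′ → ∑-comm (o a) (o d) _)) ⟩
    ∑ (o c) (λ c′ → ∑ (o d) (λ d′ → ∑ (o a) (λ a′ → ∑ (o b) (λ b′ → ∑ (substitutions o es) (λ r →
      φ ((c′ , d′) ∷ (a′ , b′) ∷ r))))))
      ≈⟨ ∑-cong (o c) (λ c′ → ∑-cong (o d) (λ d′ → sym (∑-substitutions-∷ o a b es _))) ⟩
    ∑ (o c) (λ c′ → ∑ (o d) (λ d′ → ∑ (substitutions o ((a , b) ∷ es)) (λ r → φ ((c′ , d′) ∷ r))))
      ≈⟨ sym (∑-substitutions-∷ o c d ((a , b) ∷ es) φ) ⟩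
    ∑ (substitutions o ((c , d) ∷ (a , b) ∷ es)) φ ∎
  ∑-substitutions-≋ o (≋-flip a b es) φ φ-inv = begin
    ∑ (substitutions o ((a , b) ∷ es)) φ
      ≈⟨ ∑-substitutions-∷ o a b es φ ⟩
    ∑ (o a) (λ a′ → ∑ (o b) (λ b′ → ∑ (substitutions o es) (λ r → φ ((a′ , b′) ∷ r))))
      ≈⟨ ∑-cong (o a) (λ a′ → ∑-cong (o b) (λ b′ → ∑-cong (substitutions o es) (λ r → φ-inv (≋-flip a′ b′ r)))) ⟩
    ∑ (o a) (λ a′ → ∑ (o b) (λ b′ → ∑ (substitutions o es) (λ r → φ ((b′ , a′) ∷ r))))
      ≈⟨ ∑-comm (o a) (o b) _ ⟩
    ∑ (o b) (λ b′ → ∑ (o a) (λ a′ → ∑ (substitutions o es) (λ r → φ ((b′ , a′) ∷ r))))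
      ≈⟨ sym (∑-substitutions-∷ o b a es φ) ⟩
    ∑ (substitutions o ((b , a) ∷ es)) φ ∎

targets : ℕ → List ℕ → ℕ → List ℕ
targets ∗ X a with a ≟ ∗
... | yes _ = X
... | no _  = a ∷ []

targets-∗ : ∀ ∗ X → targets ∗ X ∗ ≡ X
targets-∗ ∗ X with ∗ ≟ ∗
... | yes _ = P.refl
... | no ∗≢∗ = ⊥-elim (∗≢∗ P.refl)

targets-≢ : ∀ {∗ a} X → a ≢ ∗ → targets ∗ X a ≡ a ∷ []
targets-≢ {∗} {a} X a≢∗ with a ≟ ∗
... | yes a≡∗ = ⊥-elim (a≢∗ a≡∗)
... | no _ = P.refl

map-proj₁-mapWith∈ : ∀ {b} {B : ℕ → Set b} (xs : List ℕ) (f : ∀ {x} → x ∈ xs → B x) →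
                     map proj₁ (mapWith∈ xs (λ {x} x∈ → x , f x∈)) ≡ xs
map-proj₁-mapWith∈ [] f = P.refl
map-proj₁-mapWith∈ (x ∷ xs) f = P.cong (x ∷_) (map-proj₁-mapWith∈ xs (f ∘ there))

∖-absent : ∀ ∗ xs → ∗ ∉ xs → xs ∖ ∗ ≡ xs
∖-absent ∗ [] _ = P.refl
∖-absent ∗ (x ∷ xs) ∗∉ = P.trans (filter-accept (λ v → ¬? (v ≟ ∗)) (λ x≡∗ → ∗∉ (here (P.sym x≡∗))))
                                 (P.cong (x ∷_) (∖-absent ∗ xs (∗∉ ∘ there)))

module _ {a} {A : Set a} where

  ∈-++-∷⁺ : ∀ {x z : A} xs {ys} → z ∈ xs ++ ys → z ∈ xs ++ x ∷ ys
  ∈-++-∷⁺ xs z∈ with ∈-++⁻ xs z∈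
  ... | inj₁ z∈xs = ∈-++⁺ˡ z∈xs
  ... | inj₂ z∈ys = ∈-++⁺ʳ xs (there z∈ys)

  Unique-remove : ∀ {x : A} xs {ys} → Unique (xs ++ x ∷ ys) → x ∉ xs ++ ys × Unique (xs ++ ys)
  Unique-remove [] (x∉ys ∷ u) = (λ x∈ys → All.lookup x∉ys x∈ys P.refl) , u
  Unique-remove {x} (y ∷ xs) {ys} (y∉ ∷ u) with Unique-remove xs u
  ... | x∉ , u′ = x∉′ , All.tabulate (All.lookup y∉ ∘ ∈-++-∷⁺ xs) ∷ u′
    where
    x∉′ : x ∉ y ∷ xs ++ ys
    x∉′ (here P.refl) = All.lookup y∉ (∈-++⁺ʳ xs (here P.refl)) P.refl
    x∉′ (there x∈) = x∉ x∈

  Unique-⊆-⊇⇒↭ : ∀ (xs ys : List A) → Unique xs → Unique ys →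
                  (∀ {z} → z ∈ xs → z ∈ ys) → (∀ {z} → z ∈ ys → z ∈ xs) → xs ↭ ys
  Unique-⊆-⊇⇒↭ [] [] _ _ _ _ = Perm.refl
  Unique-⊆-⊇⇒↭ [] (y ∷ ys) _ _ _ ys⊆ with ys⊆ (here P.refl)
  ... | ()
  Unique-⊆-⊇⇒↭ (x ∷ xs) ys (x∉xs ∷ uxs) uys xs⊆ ys⊆ with ∈-∃++ (xs⊆ (here P.refl))
  ... | ys₁ , ys₂ , P.refl with Unique-remove ys₁ uys
  ... | x∉ , uys′ = Perm.trans (Perm.prep x (Unique-⊆-⊇⇒↭ xs (ys₁ ++ ys₂) uxs uys′ xs⊆′ ys⊆′))
                               (↭-sym (shift x ys₁ ys₂))
    where
    xs⊆′ : ∀ {z} → z ∈ xs → z ∈ ys₁ ++ ys₂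
    xs⊆′ z∈ with ∈-++⁻ ys₁ (xs⊆ (there z∈))
    ... | inj₁ z∈ys₁ = ∈-++⁺ˡ z∈ys₁
    ... | inj₂ (here P.refl) = ⊥-elim (All.lookup x∉xs z∈ P.refl)
    ... | inj₂ (there z∈ys₂) = ∈-++⁺ʳ ys₁ z∈ys₂
    ys⊆′ : ∀ {z} → z ∈ ys₁ ++ ys₂ → z ∈ xs
    ys⊆′ z∈ with ys⊆ (∈-++-∷⁺ ys₁ z∈)
    ... | here P.refl = ⊥-elim (x∉ z∈)
    ... | there z∈xs = z∈xs

Unique-map : ∀ {a b} {A : Set a} {B : Set b} (f : A → B) {xs} → Unique xs → (∀ {a b} → a ∈ xs → b ∈ xs → f a ≡ f b → a ≡ b) → Unique (map f xs)
Unique-map f [] f-inj = []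
Unique-map f {x ∷ xs} (x∉ ∷ u) f-inj =
  AllP.map⁺ (All.tabulate (λ y∈ fx≡fy → All.lookup x∉ y∈ (f-inj (here P.refl) (there y∈) fx≡fy)))
  ∷ Unique-map f u (λ a∈ b∈ → f-inj (there a∈) (there b∈))

Bij-injective : ∀ {V W} (σ : Bij V W) {a b} → a ∈ˢ V → b ∈ˢ V → to σ a ≡ to σ b → a ≡ b
Bij-injective σ a∈ b∈ eq = P.trans (P.sym (from-to σ a∈)) (P.trans (P.cong (from σ) eq) (from-to σ b∈))

map-Bij-↭ : ∀ {V W} (σ : Bij V W) → map (to σ) (elems V) ↭ elems W
map-Bij-↭ {V} {W} σ = Unique-⊆-⊇⇒↭ (map (to σ) (elems V)) (elems W)
  (Unique-map (to σ) (unique V) (Bij-injective σ))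
  (unique W) image⊆W W⊆image
  where
  image⊆W : ∀ {z} → z ∈ map (to σ) (elems V) → z ∈ elems W
  image⊆W z∈ with ∈-map⁻ (to σ) z∈
  ... | a , a∈ , P.refl = to∈ σ a∈
  W⊆image : ∀ {z} → z ∈ elems W → z ∈ map (to σ) (elems V)
  W⊆image z∈ = P.subst (_∈ map (to σ) (elems V)) (to-from σ z∈) (∈-map⁺ (to σ) (from∈ σ z∈))

module InsertionTerms (V₁ : FinSet) (∗ : ℕ) (V₂ : FinSet) (d : Disjoint (elems V₁) (elems V₂)) where
  open Insertion V₁ ∗ V₂ d

  map-proj₁-choose : ∀ a (a∈ : a ∈ˢ V₁) → map proj₁ (choose a a∈) ≡ targets ∗ (elems V₂) a
  map-proj₁-choose a a∈ with a ≟ ∗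
  ... | yes _ = map-proj₁-mapWith∈ (elems V₂) _
  ... | no _  = P.refl

  module _ {c ℓ} (R : CommutativeRing c ℓ) where
    open CommutativeRing R
    open Sums R
    open SubstitutionSums R
    open import Relation.Binary.Reasoning.Setoid setoid

    ∑-ins : ∀ es (ps : EdgesIn (_∈ˢ V₁) es) (φ : Edges → Carrier) →
            ∑ (ins es ps) (φ ∘ proj₁) ≈ ∑ (substitutions (targets ∗ (elems V₂)) es) φ
    ∑-ins [] [] φ = refl
    ∑-ins ((a , b) ∷ es) ((pa , pb) ∷ ps) φ = begin
      ∑ (ins ((a , b) ∷ es) ((pa , pb) ∷ ps)) (φ ∘ proj₁)
        ≈⟨ ∑-concatMap _ (choose a pa) _ ⟩
      ∑ (choose a pa) (λ t → ∑ (concatMap _ (choose b pb)) (φ ∘ proj₁))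
        ≈⟨ ∑-cong (choose a pa) (λ t → ∑-concatMap _ (choose b pb) _) ⟩
      ∑ (choose a pa) (λ t → ∑ (choose b pb) (λ u →
        ∑ (map (λ { (r , rs) → ((proj₁ t , proj₁ u) ∷ r) , ((proj₂ t , proj₂ u) ∷ rs) }) (ins es ps)) (φ ∘ proj₁)))
        ≈⟨ ∑-cong (choose a pa) (λ t → ∑-cong (choose b pb) (λ u → reflexive (∑-map _ (ins es ps) _))) ⟩
      ∑ (choose a pa) (λ t → ∑ (choose b pb) (λ u → ∑ (ins es ps) (λ m → φ ((proj₁ t , proj₁ u) ∷ proj₁ m))))
        ≈⟨ ∑-cong (choose a pa) (λ t → ∑-cong (choose b pb) (λ u → ∑-ins es ps _)) ⟩
      ∑ (choose a pa) (λ t → ∑ (choose b pb) (λ u → ψ (proj₁ t) (proj₁ u)))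
        ≈⟨ ∑-cong (choose a pa) (λ t → reflexive (P.sym (∑-map proj₁ (choose b pb) (ψ (proj₁ t))))) ⟩
      ∑ (choose a pa) (λ t → ∑ (map proj₁ (choose b pb)) (ψ (proj₁ t)))
        ≡⟨ P.sym (∑-map proj₁ (choose a pa) _) ⟩
      ∑ (map proj₁ (choose a pa)) (λ a′ → ∑ (map proj₁ (choose b pb)) (ψ a′))
        ≡⟨ P.cong₂ (λ A B → ∑ A (λ a′ → ∑ B (ψ a′))) (map-proj₁-choose a pa) (map-proj₁-choose b pb) ⟩
      ∑ (o a) (λ a′ → ∑ (o b) (ψ a′))
        ≈⟨ sym (∑-substitutions-∷ o a b es φ) ⟩
      ∑ (substitutions o ((a , b) ∷ es)) φ ∎
      where
      o = targets ∗ (elems V₂)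
      ψ : ℕ → ℕ → Carrier
      ψ a′ b′ = ∑ (substitutions o es) (λ r → φ ((a′ , b′) ∷ r))

edgesOf : ∀ {a p} {A : Set a} {P : Edges → Set p} → A × Σ Edges P → Edges
edgesOf t = proj₁ (proj₂ t)

module Coefficients {c ℓ} (K : Field c ℓ) where
  open Field K
  open Sums commutativeRing
  open import Algebra.Properties.CommutativeSemigroup +-commutativeSemigroup using (x∙yz≈y∙xz)
  open import Relation.Binary.Reasoning.Setoid setoid

  -- coeff K x g, as a function of the edge list of g only
  coeffᴱ : ∀ V → KMG[_] K V → Edges → Carrier
  coeffᴱ V x h = ∑ x (λ t → when (sameMG (edgesOf t) h) (proj₁ t))

  _≈ᴷ_ : ∀ {V} → Rel (KMG[_] K V) ℓ
  _≈ᴷ_ {V} = LinearSpeciesData._≈ₛ_ (KMG K) {V}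

  scale : ∀ {V} → Carrier → KMG[_] K V → KMG[_] K V
  scale {V} = LinearSpeciesData._·ₛ_ (KMG K) {V}

  negate : ∀ {V} → KMG[_] K V → KMG[_] K V
  negate {V} = LinearSpeciesData.-ₛ_ (KMG K) {V}

  relabel : ∀ {V W} → Bij V W → KMG[_] K V → KMG[_] K W
  relabel = LinearSpeciesData.relabel (KMG K)

  module _ (V : FinSet) where
    private
      infixr 7 _·ᵥ_
      _·ᵥ_ : Carrier → KMG[_] K V → KMG[_] K V
      _·ᵥ_ = scale {V}
      -ᵥ_ : KMG[_] K V → KMG[_] K V
      -ᵥ_ = negate {V}

    coeffᴱ-++ : ∀ (x y : KMG[_] K V) h → coeffᴱ V (x ++ y) h ≈ coeffᴱ V x h + coeffᴱ V y h
    coeffᴱ-++ x y h = ∑-++ x y _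

    coeffᴱ-negate : ∀ (x : KMG[_] K V) h → coeffᴱ V (-ᵥ x) h ≈ - coeffᴱ V x h
    coeffᴱ-negate x h = trans (reflexive (∑-map _ x _))
      (trans (∑-cong x (λ t → when-‿ (sameMG (edgesOf t) h) (proj₁ t))) (sym (-‿∑ x _)))

    coeffᴱ-scale : ∀ k (x : KMG[_] K V) h → coeffᴱ V (k ·ᵥ x) h ≈ k * coeffᴱ V x h
    coeffᴱ-scale k x h = trans (reflexive (∑-map _ x _))
      (trans (∑-cong x (λ t → when-* (sameMG (edgesOf t) h) k (proj₁ t))) (sym (*-∑ x k _)))

    isVectorSpace : IsLeftModule ring (_≈ᴷ_ {V}) _++_ [] -ᵥ_ _·ᵥ_
    isVectorSpace = record
      { isLeftSemimodule = record
        { +ᴹ-isCommutativeMonoid = record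
          { isMonoid = record
            { isSemigroup = record
              { isMagma = record
                { isEquivalence = record
                  { refl = λ g → refl
                  ; sym = λ p g → sym (p g)
                  ; trans = λ p q g → trans (p g) (q g) }
                ; ∙-cong = λ {x} {x′} {y} {y′} p q g → let h = proj₁ g in begin
                    coeffᴱ V (x ++ y) h           ≈⟨ coeffᴱ-++ x y h ⟩
                    coeffᴱ V x h + coeffᴱ V y h   ≈⟨ +-cong (p g) (q g) ⟩
                    coeffᴱ V x′ h + coeffᴱ V y′ h ≈⟨ coeffᴱ-++ x′ y′ h ⟨
                    coeffᴱ V (x′ ++ y′) h         ∎ }
              ; assoc = λ x y z g → reflexive (P.cong (λ w → coeffᴱ V w (proj₁ g)) (++-assoc x y z)) }
            ; identity = (λ x g → refl)
                       , (λ x g → reflexive (P.cong (λ w → coeffᴱ V w (proj₁ g)) (++-identityʳ x))) }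
          ; comm = λ x y g → let h = proj₁ g in begin
              coeffᴱ V (x ++ y) h         ≈⟨ coeffᴱ-++ x y h ⟩
              coeffᴱ V x h + coeffᴱ V y h ≈⟨ +-comm _ _ ⟩
              coeffᴱ V y h + coeffᴱ V x h ≈⟨ coeffᴱ-++ y x h ⟨
              coeffᴱ V (y ++ x) h         ∎ }
        ; isPreleftSemimodule = record
          { *ₗ-cong = λ {k} {k′} {x} {y} p q g → let h = proj₁ g in begin
              coeffᴱ V (k ·ᵥ x) h  ≈⟨ coeffᴱ-scale k x h ⟩
              k * coeffᴱ V x h     ≈⟨ *-cong p (q g) ⟩
              k′ * coeffᴱ V y h    ≈⟨ coeffᴱ-scale k′ y h ⟨
              coeffᴱ V (k′ ·ᵥ y) h ∎
          ; *ₗ-zeroˡ = λ x g → trans (coeffᴱ-scale 0# x (proj₁ g)) (zeroˡ _)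
          ; *ₗ-distribʳ = λ x m n g → let h = proj₁ g in begin
              coeffᴱ V ((m + n) ·ᵥ x) h                 ≈⟨ coeffᴱ-scale (m + n) x h ⟩
              (m + n) * coeffᴱ V x h                    ≈⟨ distribʳ _ _ _ ⟩
              m * coeffᴱ V x h + n * coeffᴱ V x h       ≈⟨ +-cong (coeffᴱ-scale m x h) (coeffᴱ-scale n x h) ⟨
              coeffᴱ V (m ·ᵥ x) h + coeffᴱ V (n ·ᵥ x) h ≈⟨ coeffᴱ-++ (m ·ᵥ x) (n ·ᵥ x) h ⟨
              coeffᴱ V (m ·ᵥ x ++ n ·ᵥ x) h             ∎
          ; *ₗ-identityˡ = λ x g → trans (coeffᴱ-scale 1# x (proj₁ g)) (*-identityˡ _)
          ; *ₗ-assoc = λ m n x g → let h = proj₁ g in begin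
              coeffᴱ V ((m * n) ·ᵥ x) h ≈⟨ coeffᴱ-scale (m * n) x h ⟩
              (m * n) * coeffᴱ V x h    ≈⟨ *-assoc _ _ _ ⟩
              m * (n * coeffᴱ V x h)    ≈⟨ *-congˡ (coeffᴱ-scale n x h) ⟨
              m * coeffᴱ V (n ·ᵥ x) h   ≈⟨ coeffᴱ-scale m (n ·ᵥ x) h ⟨
              coeffᴱ V (m ·ᵥ n ·ᵥ x) h  ∎
          ; *ₗ-zeroʳ = λ k g → refl
          ; *ₗ-distribˡ = λ k x y g → let h = proj₁ g in begin
              coeffᴱ V (k ·ᵥ (x ++ y)) h                ≈⟨ coeffᴱ-scale k (x ++ y) h ⟩
              k * coeffᴱ V (x ++ y) h                   ≈⟨ *-congˡ (coeffᴱ-++ x y h) ⟩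
              k * (coeffᴱ V x h + coeffᴱ V y h)         ≈⟨ distribˡ _ _ _ ⟩
              k * coeffᴱ V x h + k * coeffᴱ V y h       ≈⟨ +-cong (coeffᴱ-scale k x h) (coeffᴱ-scale k y h) ⟨
              coeffᴱ V (k ·ᵥ x) h + coeffᴱ V (k ·ᵥ y) h ≈⟨ coeffᴱ-++ (k ·ᵥ x) (k ·ᵥ y) h ⟨
              coeffᴱ V (k ·ᵥ x ++ k ·ᵥ y) h             ∎
          }
        }
      ; -ᴹ‿cong = λ {x} {y} p g → let h = proj₁ g in begin
          coeffᴱ V (-ᵥ x) h ≈⟨ coeffᴱ-negate x h ⟩
          - coeffᴱ V x h    ≈⟨ -‿cong (p g) ⟩
          - coeffᴱ V y h    ≈⟨ coeffᴱ-negate y h ⟨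
          coeffᴱ V (-ᵥ y) h ∎
      ; -ᴹ‿inverse = (λ x g → trans (coeffᴱ-++ (-ᵥ x) x (proj₁ g))
                                (trans (+-congʳ (coeffᴱ-negate x (proj₁ g))) (-‿inverseˡ _)))
                   , (λ x g → trans (coeffᴱ-++ x (-ᵥ x) (proj₁ g))
                                (trans (+-congˡ (coeffᴱ-negate x (proj₁ g))) (-‿inverseʳ _)))
      }

  coeffᴱ-relabel : ∀ {V W} (σ : Bij V W) (x : KMG[_] K V) h →
    coeffᴱ W (relabel σ x) h ≡ ∑ x (λ t → when (sameMG (relabelEdges (to σ) (edgesOf t)) h) (proj₁ t))
  coeffᴱ-relabel σ x h = ∑-map _ x _

  coeffᴱ-relabel-id : ∀ {V W} (σ : Bij V W) → (∀ {v} → v ∈ˢ V → to σ v ≡ v) →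
                      ∀ x h → coeffᴱ W (relabel σ x) h ≈ coeffᴱ V x h
  coeffᴱ-relabel-id σ σ≗id x h = trans (reflexive (coeffᴱ-relabel σ x h)) (∑-cong x (λ t →
    reflexive (P.cong (λ es → when (sameMG es h) (proj₁ t)) (relabelEdges-id σ≗id (proj₂ (proj₂ t))))))

  Bij⁻¹ : ∀ {V W} → Bij V W → Bij W V
  Bij⁻¹ σ = record { to = from σ ; from = to σ ; to∈ = from∈ σ ; from∈ = to∈ σ
                   ; from-to = to-from σ ; to-from = from-to σ }

  coeffᴱ-relabel-Bij⁻¹ : ∀ {V W} (σ : Bij V W) x (g : MG W) →
    coeffᴱ W (relabel σ x) (proj₁ g) ≈ coeffᴱ V x (proj₁ (relabelMG (Bij⁻¹ σ) g))
  coeffᴱ-relabel-Bij⁻¹ σ x g = trans (reflexive (coeffᴱ-relabel σ x (proj₁ g))) (∑-cong x (λ t →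
    reflexive (P.cong (λ b → when b (proj₁ t))
      (sameMG-relabel (to σ) (from σ) (from-to σ) (to-from σ) (proj₂ (proj₂ t)) (proj₂ g)))))

  isLinearSpecies : IsLinearSpecies (KMG K)
  isLinearSpecies = record
    { isVectorSpace = isVectorSpace
    ; relabel-cong = λ {V} {W} σ {x} {y} x≈y g → begin
        coeffᴱ W (relabel σ x) (proj₁ g)                       ≈⟨ coeffᴱ-relabel-Bij⁻¹ σ x g ⟩
        coeffᴱ V x (proj₁ (relabelMG (Bij⁻¹ σ) g))             ≈⟨ x≈y (relabelMG (Bij⁻¹ σ) g) ⟩
        coeffᴱ V y (proj₁ (relabelMG (Bij⁻¹ σ) g))             ≈⟨ coeffᴱ-relabel-Bij⁻¹ σ y g ⟨
        coeffᴱ W (relabel σ y) (proj₁ g)                       ∎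
    ; relabel-+ = λ {V} {W} σ x y g → reflexive (P.cong (λ w → coeffᴱ W w (proj₁ g)) (map-++ _ x y))
    ; relabel-· = λ {V} {W} σ k x g →
        reflexive (P.cong (λ w → coeffᴱ W w (proj₁ g)) (P.trans (P.sym (map-∘ x)) (map-∘ x)))
    ; relabel-id = λ {V} σ σ≗id x g → coeffᴱ-relabel-id σ σ≗id x (proj₁ g)
    ; relabel-∘ = λ {U} {V} {W} σ τ ρ ρ≗τσ x g → let h = proj₁ g in begin
        coeffᴱ W (relabel ρ x) h
          ≡⟨ coeffᴱ-relabel ρ x h ⟩
        ∑ x (λ t → when (sameMG (relabelEdges (to ρ) (edgesOf t)) h) (proj₁ t))
          ≈⟨ ∑-cong x (λ t → reflexive (P.cong (λ es → when (sameMG es h) (proj₁ t))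
               (P.trans (relabelEdges-cong ρ≗τσ (proj₂ (proj₂ t)))
                        (P.sym (relabelEdges-∘ (to σ) (to τ) (edgesOf t)))))) ⟩
        ∑ x (λ t → when (sameMG (relabelEdges (to τ) (relabelEdges (to σ) (edgesOf t))) h) (proj₁ t))
          ≡⟨ P.sym (P.trans (coeffᴱ-relabel τ (relabel σ x) h) (∑-map _ x _)) ⟩
        coeffᴱ W (relabel τ (relabel σ x)) h ∎
    }

  module _ {V : FinSet} where

    without : MG V → KMG[_] K V → KMG[_] K V
    without g [] = []
    without g (t ∷ xs) with sameMG (edgesOf t) (proj₁ g)
    ... | true  = without g xs
    ... | false = t ∷ without g xs

    length-without : ∀ g xs → length (without g xs) ≤ length xs
    length-without g [] = z≤n
    length-without g (t ∷ xs) with sameMG (edgesOf t) (proj₁ g)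
    ... | true  = ≤-trans (length-without g xs) (n≤1+n _)
    ... | false = s≤s (length-without g xs)

    without-head : ∀ t xs → without (proj₂ t) (t ∷ xs) ≡ without (proj₂ t) xs
    without-head t xs rewrite ≋⇒sameMG (≋-refl {edgesOf t}) = P.refl

    coeffᴱ-without-same : ∀ g h xs → sameMG (proj₁ g) h ≡ true → coeffᴱ V (without g xs) h ≈ 0#
    coeffᴱ-without-same g h [] g≋h = refl
    coeffᴱ-without-same g h (t ∷ xs) g≋h with sameMG (edgesOf t) (proj₁ g) in t≋g
    ... | true  = coeffᴱ-without-same g h xs g≋h
    ... | false = trans (+-cong (reflexive (P.cong (λ b → when b (proj₁ t)) t≉h)) (coeffᴱ-without-same g h xs g≋h))
                        (+-identityˡ _)
      where
      t≉h : sameMG (edgesOf t) h ≡ false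
      t≉h = P.trans (P.sym (sameMG-respʳ (sameMG⇒≋ {proj₁ g} {h} g≋h) (edgesOf t))) t≋g

    coeffᴱ-without-other : ∀ g h xs → sameMG (proj₁ g) h ≡ false → coeffᴱ V (without g xs) h ≈ coeffᴱ V xs h
    coeffᴱ-without-other g h [] g≉h = refl
    coeffᴱ-without-other g h (t ∷ xs) g≉h with sameMG (edgesOf t) (proj₁ g) in t≋g
    ... | true  = trans (coeffᴱ-without-other g h xs g≉h)
                        (sym (trans (+-congʳ (reflexive (P.cong (λ b → when b (proj₁ t)) t≉h))) (+-identityˡ _)))
      where
      t≉h : sameMG (edgesOf t) h ≡ false
      t≉h = P.trans (sameMG-respˡ (sameMG⇒≋ {edgesOf t} {proj₁ g} t≋g) h) g≉h
    ... | false = +-congˡ (coeffᴱ-without-other g h xs g≉h)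

    without-resp-≈ᴷ : ∀ g {x y} → _≈ᴷ_ {V} x y → _≈ᴷ_ {V} (without g x) (without g y)
    without-resp-≈ᴷ g {x} {y} x≈y g′ with sameMG (proj₁ g) (proj₁ g′) in g≋g′
    ... | true  = trans (coeffᴱ-without-same g (proj₁ g′) x g≋g′) (sym (coeffᴱ-without-same g (proj₁ g′) y g≋g′))
    ... | false = trans (coeffᴱ-without-other g (proj₁ g′) x g≋g′)
                        (trans (x≈y g′) (sym (coeffᴱ-without-other g (proj₁ g′) y g≋g′)))

    module _ (F : MG V → Carrier) (F-resp : ∀ u v → sameMG (proj₁ u) (proj₁ v) ≡ true → F u ≈ F v) where

      weighted : KMG[_] K V → Carrier
      weighted x = ∑ x (λ t → proj₁ t * F (proj₂ t))

      weighted-split : ∀ g xs → weighted xs ≈ coeffᴱ V xs (proj₁ g) * F g + weighted (without g xs)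
      weighted-split g [] = sym (trans (+-identityʳ _) (zeroˡ _))
      weighted-split g (t ∷ xs) with sameMG (edgesOf t) (proj₁ g) in t≋g
      ... | true = begin
        proj₁ t * F (proj₂ t) + weighted xs
          ≈⟨ +-cong (*-congˡ (F-resp _ _ t≋g)) (weighted-split g xs) ⟩
        proj₁ t * F g + (coeffᴱ V xs (proj₁ g) * F g + weighted (without g xs))
          ≈⟨ sym (+-assoc _ _ _) ⟩
        (proj₁ t * F g + coeffᴱ V xs (proj₁ g) * F g) + weighted (without g xs)
          ≈⟨ +-congʳ (sym (distribʳ _ _ _)) ⟩
        (proj₁ t + coeffᴱ V xs (proj₁ g)) * F g + weighted (without g xs) ∎
      ... | false = begin
        proj₁ t * F (proj₂ t) + weighted xs
          ≈⟨ +-congˡ (weighted-split g xs) ⟩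
        proj₁ t * F (proj₂ t) + (coeffᴱ V xs (proj₁ g) * F g + weighted (without g xs))
          ≈⟨ x∙yz≈y∙xz _ _ _ ⟩
        coeffᴱ V xs (proj₁ g) * F g + (proj₁ t * F (proj₂ t) + weighted (without g xs))
          ≈⟨ +-congʳ (*-congʳ (sym (+-identityˡ _))) ⟩
        (0# + coeffᴱ V xs (proj₁ g)) * F g + (proj₁ t * F (proj₂ t) + weighted (without g xs)) ∎

      -- Both sides lose all terms equal to the head of x; these contribute the same multiple of F.
      weighted-resp-≈ᴷ-step : ∀ n t xs y → length xs +ℕ length y ≤ n → _≈ᴷ_ {V} (t ∷ xs) y →
        (∀ x′ y′ → length x′ +ℕ length y′ ≤ n → _≈ᴷ_ {V} x′ y′ → weighted x′ ≈ weighted y′) →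
        weighted (t ∷ xs) ≈ weighted y
      weighted-resp-≈ᴷ-step n t xs y len x≈y ih = begin
        weighted (t ∷ xs)
          ≈⟨ weighted-split g (t ∷ xs) ⟩
        coeffᴱ V (t ∷ xs) (proj₁ g) * F g + weighted (without g (t ∷ xs))
          ≈⟨ +-cong (*-congʳ (x≈y g)) (ih (without g (t ∷ xs)) (without g y) len′ (without-resp-≈ᴷ g {t ∷ xs} {y} x≈y)) ⟩
        coeffᴱ V y (proj₁ g) * F g + weighted (without g y)
          ≈⟨ weighted-split g y ⟨
        weighted y ∎
        where
        g = proj₂ t
        len′ : length (without g (t ∷ xs)) +ℕ length (without g y) ≤ n
        len′ rewrite without-head t xs = ≤-trans (+-mono-≤ (length-without g xs) (length-without g y)) len

      weighted-resp-≈ᴷ-bounded : ∀ n x y → length x +ℕ length y ≤ n → _≈ᴷ_ {V} x y → weighted x ≈ weighted y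
      weighted-resp-≈ᴷ-bounded n [] [] _ _ = refl
      weighted-resp-≈ᴷ-bounded (suc n) (t ∷ xs) y (s≤s len) x≈y =
        weighted-resp-≈ᴷ-step n t xs y len x≈y (weighted-resp-≈ᴷ-bounded n)
      weighted-resp-≈ᴷ-bounded (suc n) [] (t ∷ ys) (s≤s len) x≈y = sym
        (weighted-resp-≈ᴷ-step n t ys [] (P.subst (_≤ n) (P.sym (+ℕ-identityʳ _)) len) (λ g → sym (x≈y g))
          (weighted-resp-≈ᴷ-bounded n))

      weighted-resp-≈ᴷ : ∀ {x y} → _≈ᴷ_ {V} x y → weighted x ≈ weighted y
      weighted-resp-≈ᴷ {x} {y} = weighted-resp-≈ᴷ-bounded _ x y ≤-refl

module Operad {c ℓ} (K : Field c ℓ) where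
  open Field K
  open Sums commutativeRing
  open SubstitutionSums commutativeRing
  open Coefficients K
  open import Relation.Binary.Reasoning.Setoid setoid
  open import Algebra.Properties.CommutativeSemigroup *-commutativeSemigroup using (x∙yz≈y∙xz; xy∙z≈xz∙y)

  ∑-insertion : ∀ {V₁ V₂} ∗ (p : ∗ ∈ˢ V₁) (d : Disjoint (elems V₁) (elems V₂)) x y (Φ : Carrier → Edges → Carrier) →
    ∑ (insertionMG K ∗ p d x y) (λ w → Φ (proj₁ w) (edgesOf w)) ≈
    ∑ x (λ s → ∑ y (λ t → ∑ (substitutions (targets ∗ (elems V₂)) (edgesOf s)) (λ r →
      Φ (proj₁ s * proj₁ t) (r ++ edgesOf t))))
  ∑-insertion {V₁} {V₂} ∗ p d x y Φ = begin
    ∑ (insertionMG K ∗ p d x y) (λ w → Φ (proj₁ w) (edgesOf w))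
      ≈⟨ ∑-concatMap _ x _ ⟩
    _ ≈⟨ ∑-cong x (λ s → trans (∑-concatMap _ y _) (∑-cong y (λ t →
          trans (reflexive (∑-map _ (Insertion.insert V₁ ∗ V₂ d (proj₂ s) (proj₂ t)) _))
         (trans (reflexive (∑-map _ (Insertion.ins V₁ ∗ V₂ d (edgesOf s) (proj₂ (proj₂ s))) _))
                (InsertionTerms.∑-ins V₁ ∗ V₂ d commutativeRing (edgesOf s) (proj₂ (proj₂ s)) _))))) ⟩
    _ ∎

  ∑-targets-absent : ∀ ∗ X L → ∗ ∉ L → ∀ (ψ : ℕ → Carrier) → ∑ L (λ a → ∑ (targets ∗ X a) ψ) ≈ ∑ L ψ
  ∑-targets-absent ∗ X [] ∗∉ ψ = refl
  ∑-targets-absent ∗ X (a ∷ L) ∗∉ ψ = +-cong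
    (trans (reflexive (P.cong (λ A → ∑ A ψ) (targets-≢ X (λ a≡∗ → ∗∉ (here (P.sym a≡∗)))))) (+-identityʳ _))
    (∑-targets-absent ∗ X L (∗∉ ∘ there) ψ)

  ∑-targets-unique : ∀ ∗ X L → Unique L → ∗ ∈ L → ∀ (ψ : ℕ → Carrier) →
                     ∑ L (λ a → ∑ (targets ∗ X a) ψ) ≈ ∑ (L ∖ ∗ ++ X) ψ
  ∑-targets-unique ∗ X (a ∷ L) (a∉L ∷ u) ∗∈ ψ with a ≟ ∗
  ... | yes P.refl rewrite filter-reject (λ v → ¬? (v ≟ ∗)) {a} {L} (λ ∗≢∗ → ∗≢∗ P.refl) = begin
    ∑ X ψ + ∑ L (λ a → ∑ (targets ∗ X a) ψ) ≈⟨ +-congˡ (∑-targets-absent ∗ X L ∗∉L ψ) ⟩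
    ∑ X ψ + ∑ L ψ                           ≈⟨ +-comm _ _ ⟩
    ∑ L ψ + ∑ X ψ                           ≈⟨ ∑-++ L X ψ ⟨
    ∑ (L ++ X) ψ                            ≡⟨ P.cong (λ M → ∑ (M ++ X) ψ) (∖-absent ∗ L ∗∉L) ⟨
    ∑ (L ∖ ∗ ++ X) ψ                        ∎
    where
    ∗∉L : ∗ ∉ L
    ∗∉L ∗∈L = All.lookup a∉L ∗∈L P.refl
  ... | no a≢∗ with ∗∈
  ...   | here ∗≡a = ⊥-elim (a≢∗ (P.sym ∗≡a))
  ...   | there ∗∈L rewrite filter-accept (λ v → ¬? (v ≟ ∗)) {a} {L} a≢∗ =
    +-cong (+-identityʳ _) (∑-targets-unique ∗ X L u ∗∈L ψ)

  module Composite (V₁ : FinSet) (∗ : ℕ) (V₂ : FinSet) (p : ∗ ∈ˢ V₁) (d : Disjoint (elems V₁) (elems V₂)) where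

    W : FinSet
    W = graft V₁ ∗ V₂ d

    o : ℕ → List ℕ
    o = targets ∗ (elems V₂)

    infixl 7 _⊚_
    _⊚_ : KMG[_] K V₁ → KMG[_] K V₂ → KMG[_] K W
    x ⊚ y = insertionMG K {V₁} {V₂} ∗ p d x y

    count : Edges → Edges → Edges → Carrier
    count h S T = ∑ (substitutions o S) (λ r → when (sameMG (r ++ T) h) 1#)

    coeffᴱ-⊚ : ∀ x y h → coeffᴱ W (x ⊚ y) h ≈
      ∑ x (λ s → ∑ y (λ t → (proj₁ s * proj₁ t) * count h (edgesOf s) (edgesOf t)))
    coeffᴱ-⊚ x y h = begin
      coeffᴱ W (x ⊚ y) h
        ≈⟨ ∑-insertion ∗ p d x y (λ k es → when (sameMG es h) k) ⟩
      ∑ x (λ s → ∑ y (λ t → ∑ (substitutions o (edgesOf s)) (λ r →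
        when (sameMG (r ++ edgesOf t) h) (proj₁ s * proj₁ t))))
        ≈⟨ ∑-cong x (λ s → ∑-cong y (λ t → ∑-cong (substitutions o (edgesOf s)) (λ r →
             trans (when-cong _ (sym (*-identityʳ _))) (when-* _ _ 1#)))) ⟩
      ∑ x (λ s → ∑ y (λ t → ∑ (substitutions o (edgesOf s)) (λ r →
        (proj₁ s * proj₁ t) * when (sameMG (r ++ edgesOf t) h) 1#)))
        ≈⟨ ∑-cong x (λ s → ∑-cong y (λ t → sym (*-∑ (substitutions o (edgesOf s)) _ _))) ⟩
      ∑ x (λ s → ∑ y (λ t → (proj₁ s * proj₁ t) * count h (edgesOf s) (edgesOf t))) ∎

    count-≋ˡ : ∀ h T {S S′} → S ≋ S′ → count h S T ≈ count h S′ T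
    count-≋ˡ h T S≋S′ = ∑-substitutions-≋ o S≋S′ (λ r → when (sameMG (r ++ T) h) 1#)
      (λ r≋r′ → reflexive (P.cong (λ b → when b 1#) (sameMG-respˡ (≋-++ʳ T r≋r′) h)))

    count-≋ʳ : ∀ h S {T T′} → T ≋ T′ → count h S T ≈ count h S T′
    count-≋ʳ h S T≋T′ = ∑-cong (substitutions o S) (λ r →
      reflexive (P.cong (λ b → when b 1#) (sameMG-respˡ (≋-++ˡ r T≋T′) h)))

    ⊚-cong : ∀ {x x′ y y′} → _≈ᴷ_ {V₁} x x′ → _≈ᴷ_ {V₂} y y′ → _≈ᴷ_ {W} (x ⊚ y) (x′ ⊚ y′)
    ⊚-cong {x} {x′} {y} {y′} x≈x′ y≈y′ g = begin
      coeffᴱ W (x ⊚ y) h    ≈⟨ coeffᴱ-⊚ x y h ⟩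
      ∑ x (λ s → ∑ y (λ t → (proj₁ s * proj₁ t) * count h (edgesOf s) (edgesOf t)))
        ≈⟨ ∑-cong x (λ s → normalise s y) ⟩
      weighted {V₁} F₁ F₁-resp x ≈⟨ weighted-resp-≈ᴷ {V₁} F₁ F₁-resp {x} {x′} x≈x′ ⟩
      weighted {V₁} F₁ F₁-resp x′
        ≈⟨ ∑-cong x′ (λ s → *-congˡ (weighted-resp-≈ᴷ {V₂} (F₂ s) (F₂-resp s) {y} {y′} y≈y′)) ⟩
      ∑ x′ (λ s → proj₁ s * ∑ y′ (λ t → proj₁ t * count h (edgesOf s) (edgesOf t)))
        ≈⟨ ∑-cong x′ (λ s → normalise s y′) ⟨
      ∑ x′ (λ s → ∑ y′ (λ t → (proj₁ s * proj₁ t) * count h (edgesOf s) (edgesOf t)))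
        ≈⟨ coeffᴱ-⊚ x′ y′ h ⟨
      coeffᴱ W (x′ ⊚ y′) h  ∎
      where
      h = proj₁ g
      normalise : ∀ (s : Carrier × MG V₁) z →
        ∑ z (λ t → (proj₁ s * proj₁ t) * count h (edgesOf s) (edgesOf t)) ≈
        proj₁ s * ∑ z (λ t → proj₁ t * count h (edgesOf s) (edgesOf t))
      normalise s z = trans (∑-cong z (λ t → *-assoc _ _ _)) (sym (*-∑ z _ _))
      F₁ : MG V₁ → Carrier
      F₁ g₁ = ∑ y (λ t → proj₁ t * count h (proj₁ g₁) (edgesOf t))
      F₁-resp : ∀ (u v : MG V₁) → sameMG (proj₁ u) (proj₁ v) ≡ true → F₁ u ≈ F₁ v
      F₁-resp u v u≋v = ∑-cong y (λ t → *-congˡ (count-≋ˡ h (edgesOf t) (sameMG⇒≋ {proj₁ u} {proj₁ v} u≋v)))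
      F₂ : Carrier × MG V₁ → MG V₂ → Carrier
      F₂ s g₂ = count h (edgesOf s) (proj₁ g₂)
      F₂-resp : ∀ s (u v : MG V₂) → sameMG (proj₁ u) (proj₁ v) ≡ true → F₂ s u ≈ F₂ s v
      F₂-resp s u v u≋v = count-≋ʳ h (edgesOf s) (sameMG⇒≋ {proj₁ u} {proj₁ v} u≋v)

    ⊚-+ˡ : ∀ x x′ y → _≈ᴷ_ {W} ((x ++ x′) ⊚ y) (x ⊚ y ++ x′ ⊚ y)
    ⊚-+ˡ x x′ y g = reflexive (P.cong (λ w → coeffᴱ W w (proj₁ g)) (concatMap-++ _ x x′))

    ⊚-+ʳ : ∀ x y y′ → _≈ᴷ_ {W} (x ⊚ (y ++ y′)) (x ⊚ y ++ x ⊚ y′)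
    ⊚-+ʳ x y y′ g = begin
      coeffᴱ W (x ⊚ (y ++ y′)) h                ≈⟨ coeffᴱ-⊚ x (y ++ y′) h ⟩
      ∑ x (λ s → ∑ (y ++ y′) (f s))             ≈⟨ ∑-cong x (λ s → ∑-++ y y′ (f s)) ⟩
      ∑ x (λ s → ∑ y (f s) + ∑ y′ (f s))        ≈⟨ ∑-+ x _ _ ⟩
      ∑ x (λ s → ∑ y (f s)) + ∑ x (λ s → ∑ y′ (f s))
        ≈⟨ +-cong (coeffᴱ-⊚ x y h) (coeffᴱ-⊚ x y′ h) ⟨
      coeffᴱ W (x ⊚ y) h + coeffᴱ W (x ⊚ y′) h ≈⟨ coeffᴱ-++ W (x ⊚ y) (x ⊚ y′) h ⟨
      coeffᴱ W (x ⊚ y ++ x ⊚ y′) h             ∎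
      where
      h = proj₁ g
      f : Carrier × MG V₁ → Carrier × MG V₂ → Carrier
      f s t = (proj₁ s * proj₁ t) * count h (edgesOf s) (edgesOf t)

    ⊚-·ˡ : ∀ k x y → _≈ᴷ_ {W} (scale {V₁} k x ⊚ y) (scale {W} k (x ⊚ y))
    ⊚-·ˡ k x y g = begin
      coeffᴱ W (scale {V₁} k x ⊚ y) h
        ≈⟨ coeffᴱ-⊚ (scale {V₁} k x) y h ⟩
      ∑ (scale {V₁} k x) (λ s → ∑ y (λ t → (proj₁ s * proj₁ t) * count h (edgesOf s) (edgesOf t)))
        ≡⟨ ∑-map _ x _ ⟩
      ∑ x (λ s → ∑ y (λ t → ((k * proj₁ s) * proj₁ t) * count h (edgesOf s) (edgesOf t)))
        ≈⟨ ∑-cong x (λ s → ∑-cong y (λ t → trans (*-congʳ (*-assoc _ _ _)) (*-assoc _ _ _))) ⟩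
      ∑ x (λ s → ∑ y (λ t → k * ((proj₁ s * proj₁ t) * count h (edgesOf s) (edgesOf t))))
        ≈⟨ *-∑∑ x y k _ ⟨
      k * ∑ x (λ s → ∑ y (λ t → (proj₁ s * proj₁ t) * count h (edgesOf s) (edgesOf t)))
        ≈⟨ *-congˡ (coeffᴱ-⊚ x y h) ⟨
      k * coeffᴱ W (x ⊚ y) h
        ≈⟨ coeffᴱ-scale W k (x ⊚ y) h ⟨
      coeffᴱ W (scale {W} k (x ⊚ y)) h ∎
      where h = proj₁ g

    ⊚-·ʳ : ∀ k x y → _≈ᴷ_ {W} (x ⊚ scale {V₂} k y) (scale {W} k (x ⊚ y))
    ⊚-·ʳ k x y g = begin
      coeffᴱ W (x ⊚ scale {V₂} k y) h
        ≈⟨ coeffᴱ-⊚ x (scale {V₂} k y) h ⟩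
      ∑ x (λ s → ∑ (scale {V₂} k y) (λ t → (proj₁ s * proj₁ t) * count h (edgesOf s) (edgesOf t)))
        ≈⟨ ∑-cong x (λ s → reflexive (∑-map _ y _)) ⟩
      ∑ x (λ s → ∑ y (λ t → (proj₁ s * (k * proj₁ t)) * count h (edgesOf s) (edgesOf t)))
        ≈⟨ ∑-cong x (λ s → ∑-cong y (λ t → trans (*-congʳ (x∙yz≈y∙xz _ _ _)) (*-assoc _ _ _))) ⟩
      ∑ x (λ s → ∑ y (λ t → k * ((proj₁ s * proj₁ t) * count h (edgesOf s) (edgesOf t))))
        ≈⟨ *-∑∑ x y k _ ⟨
      k * ∑ x (λ s → ∑ y (λ t → (proj₁ s * proj₁ t) * count h (edgesOf s) (edgesOf t)))
        ≈⟨ *-congˡ (coeffᴱ-⊚ x y h) ⟨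
      k * coeffᴱ W (x ⊚ y) h
        ≈⟨ coeffᴱ-scale W k (x ⊚ y) h ⟨
      coeffᴱ W (scale {W} k (x ⊚ y)) h ∎
      where h = proj₁ g

  module Iterated (V₁ : FinSet) (∗₁ : ℕ) (V₂ : FinSet) (p₁ : ∗₁ ∈ˢ V₁) (d₁₂ : Disjoint (elems V₁) (elems V₂))
                  (∗₂ : ℕ) (V₃ : FinSet) (p₂ : ∗₂ ∈ˢ graft V₁ ∗₁ V₂ d₁₂)
                  (d : Disjoint (elems (graft V₁ ∗₁ V₂ d₁₂)) (elems V₃)) where
    open Composite V₁ ∗₁ V₂ p₁ d₁₂ using () renaming (_⊚_ to _⊚₁_; o to o₁)
    open Composite (graft V₁ ∗₁ V₂ d₁₂) ∗₂ V₃ p₂ d using () renaming (_⊚_ to _⊚₂_; o to o₂; W to W₁₂₃)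

    coeffᴱ-⊚⊚ : ∀ x y z h → coeffᴱ W₁₂₃ ((x ⊚₁ y) ⊚₂ z) h ≈
      ∑ x (λ s → ∑ y (λ t → ∑ (substitutions o₁ (edgesOf s)) (λ r → ∑ z (λ u →
        ∑ (substitutions o₂ (r ++ edgesOf t)) (λ r′ → when (sameMG (r′ ++ edgesOf u) h) ((proj₁ s * proj₁ t) * proj₁ u))))))
    coeffᴱ-⊚⊚ x y z h = begin
      coeffᴱ W₁₂₃ ((x ⊚₁ y) ⊚₂ z) h
        ≈⟨ ∑-insertion ∗₂ p₂ d (x ⊚₁ y) z (λ k es → when (sameMG es h) k) ⟩
      ∑ (x ⊚₁ y) (λ w → ∑ z (λ u → ∑ (substitutions o₂ (edgesOf w)) (λ r′ →
        when (sameMG (r′ ++ edgesOf u) h) (proj₁ w * proj₁ u))))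
        ≈⟨ ∑-insertion ∗₁ p₁ d₁₂ x y (λ k es → ∑ z (λ u → ∑ (substitutions o₂ es) (λ r′ →
             when (sameMG (r′ ++ edgesOf u) h) (k * proj₁ u)))) ⟩
      ∑ x (λ s → ∑ y (λ t → ∑ (substitutions o₁ (edgesOf s)) (λ r → ∑ z (λ u →
        ∑ (substitutions o₂ (r ++ edgesOf t)) (λ r′ → when (sameMG (r′ ++ edgesOf u) h) ((proj₁ s * proj₁ t) * proj₁ u)))))) ∎

  module _ {V₁ V₂ W₁ W₂ : FinSet} {∗ : ℕ} (p : ∗ ∈ˢ V₁) (d : Disjoint (elems V₁) (elems V₂))
           (σ₁ : Bij V₁ W₁) (σ₂ : Bij V₂ W₂) (p′ : to σ₁ ∗ ∈ˢ W₁) (d′ : Disjoint (elems W₁) (elems W₂))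
           (σ : Bij (graft V₁ ∗ V₂ d) (graft W₁ (to σ₁ ∗) W₂ d′))
           (σ≗σ₁ : ∀ {v} → v ∈ˢ V₁ → v ≢ ∗ → to σ v ≡ to σ₁ v) (σ≗σ₂ : ∀ {v} → v ∈ˢ V₂ → to σ v ≡ to σ₂ v) where
    open Composite V₁ ∗ V₂ p d using (_⊚_) renaming (o to o₁)
    open Composite W₁ (to σ₁ ∗) W₂ p′ d′ using () renaming (_⊚_ to _⊚′_; o to o₂; W to W′)

    ∑-relabel-targets : ∀ {a} → a ∈ˢ V₁ → ∀ (χ : ℕ → Carrier) → ∑ (map (to σ) (o₁ a)) χ ≈ ∑ (o₂ (to σ₁ a)) χ
    ∑-relabel-targets {a} a∈ χ with a ≟ ∗
    ... | yes P.refl rewrite targets-∗ (to σ₁ a) (elems W₂) = begin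
      ∑ (map (to σ) (elems V₂)) χ       ≡⟨ ∑-map (to σ) (elems V₂) χ ⟩
      ∑ (elems V₂) (χ ∘ to σ)           ≈⟨ ∑-cong-∈ (elems V₂) (λ v∈ → reflexive (P.cong χ (σ≗σ₂ v∈))) ⟩
      ∑ (elems V₂) (χ ∘ to σ₂)          ≡⟨ ∑-map (to σ₂) (elems V₂) χ ⟨
      ∑ (map (to σ₂) (elems V₂)) χ      ≈⟨ ∑-↭ χ (map-Bij-↭ σ₂) ⟩
      ∑ (elems W₂) χ                    ∎
    ... | no a≢∗ rewrite targets-≢ (elems W₂) (a≢∗ ∘ Bij-injective σ₁ a∈ p) =
      +-congʳ (reflexive (P.cong χ (σ≗σ₁ a∈ a≢∗)))

    ⊚-relabel : ∀ x y → _≈ᴷ_ {W′} (relabel σ (x ⊚ y)) (relabel σ₁ x ⊚′ relabel σ₂ y)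
    ⊚-relabel x y g = begin
      coeffᴱ W′ (relabel σ (x ⊚ y)) h
        ≡⟨ coeffᴱ-relabel σ (x ⊚ y) h ⟩
      _ ≈⟨ ∑-insertion ∗ p d x y (λ k es → when (sameMG (relabelEdges (to σ) es) h) k) ⟩
      ∑ x (λ s → ∑ y (λ t → ∑ (substitutions o₁ (edgesOf s)) (λ r →
        when (sameMG (relabelEdges (to σ) (r ++ edgesOf t)) h) (proj₁ s * proj₁ t))))
        ≈⟨ ∑-cong x (λ s → ∑-cong y (λ t → relabel-inside s t)) ⟩
      ∑ x (λ s → ∑ y (λ t → ∑ (substitutions o₂ (relabelEdges (to σ₁) (edgesOf s))) (λ r →
        when (sameMG (r ++ relabelEdges (to σ₂) (edgesOf t)) h) (proj₁ s * proj₁ t))))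
        ≡⟨ ∑-map _ x _ ⟨
      _ ≈⟨ ∑-cong (relabel σ₁ x) (λ s → reflexive (P.sym (∑-map _ y _))) ⟩
      _ ≈⟨ ∑-insertion (to σ₁ ∗) p′ d′ (relabel σ₁ x) (relabel σ₂ y) (λ k es → when (sameMG es h) k) ⟨
      coeffᴱ W′ (relabel σ₁ x ⊚′ relabel σ₂ y) h ∎
      where
      h = proj₁ g
      relabel-inside : ∀ (s : Carrier × MG V₁) (t : Carrier × MG V₂) →
        ∑ (substitutions o₁ (edgesOf s)) (λ r → when (sameMG (relabelEdges (to σ) (r ++ edgesOf t)) h) (proj₁ s * proj₁ t)) ≈
        ∑ (substitutions o₂ (relabelEdges (to σ₁) (edgesOf s))) (λ r →
          when (sameMG (r ++ relabelEdges (to σ₂) (edgesOf t)) h) (proj₁ s * proj₁ t))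
      relabel-inside s t = begin
        _ ≈⟨ ∑-cong (substitutions o₁ (edgesOf s)) (λ r → reflexive (P.cong (λ es → when (sameMG es h) (proj₁ s * proj₁ t))
               (P.trans (map-++ _ r (edgesOf t)) (P.cong (relabelEdges (to σ) r ++_)
                  (relabelEdges-cong σ≗σ₂ (proj₂ (proj₂ t))))))) ⟩
        ∑ (substitutions o₁ (edgesOf s)) (ψ ∘ relabelEdges (to σ))
          ≈⟨ ∑-substitutions-relabel o₁ (to σ) (edgesOf s) ψ ⟩
        ∑ (substitutions (map (to σ) ∘ o₁) (edgesOf s)) ψ
          ≈⟨ ∑-substitutions-cong _ _ ∑-relabel-targets (proj₂ (proj₂ s)) ψ ⟩
        ∑ (substitutions (o₂ ∘ to σ₁) (edgesOf s)) ψ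
          ≡⟨ P.cong (λ L → ∑ L ψ) (substitutions-relabel o₂ (to σ₁) (edgesOf s)) ⟨
        ∑ (substitutions o₂ (relabelEdges (to σ₁) (edgesOf s))) ψ ∎
        where
        ψ : Edges → Carrier
        ψ r = when (sameMG (r ++ relabelEdges (to σ₂) (edgesOf t)) h) (proj₁ s * proj₁ t)

  ⊚-unitˡ : ∀ {V} (v : ℕ) (p : v ∈ˢ singleton v) (d : Disjoint (v ∷ []) (elems V))
              (σ : Bij (graft (singleton v) v V d) V) → (∀ {u} → u ∈ˢ graft (singleton v) v V d → to σ u ≡ u) →
              ∀ x → _≈ᴷ_ {V} (relabel σ (Composite._⊚_ (singleton v) v V p d (unitMG K v) x)) x
  ⊚-unitˡ {V} v p d σ σ≗id x g = begin
    coeffᴱ V (relabel σ (unitMG K v ⊚ x)) h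
      ≈⟨ coeffᴱ-relabel-id σ σ≗id (unitMG K v ⊚ x) h ⟩
    coeffᴱ W (unitMG K v ⊚ x) h
      ≈⟨ ∑-insertion {singleton v} {V} v p d (unitMG K v) x (λ k es → when (sameMG es h) k) ⟩
    ∑ x (λ t → when (sameMG (edgesOf t) h) (1# * proj₁ t) + 0#) + 0#
      ≈⟨ +-identityʳ _ ⟩
    ∑ x (λ t → when (sameMG (edgesOf t) h) (1# * proj₁ t) + 0#)
      ≈⟨ ∑-cong x (λ t → trans (+-identityʳ _) (when-cong _ (*-identityˡ _))) ⟩
    coeffᴱ V x h ∎
    where
    open Composite (singleton v) v V p d using (_⊚_; W)
    h = proj₁ g

  replace : ℕ → ℕ → ℕ → ℕ
  replace ∗ v a with a ≟ ∗
  ... | yes _ = v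
  ... | no _  = a

  ⊚-unitʳ : ∀ {V} (∗ v : ℕ) (p : ∗ ∈ˢ V) (d : Disjoint (elems V) (v ∷ []))
              (σ : Bij (graft V ∗ (singleton v) d) V) → to σ v ≡ ∗ → (∀ {u} → u ∈ˢ V → u ≢ ∗ → to σ u ≡ u) →
              ∀ x → _≈ᴷ_ {V} (relabel σ (Composite._⊚_ V ∗ (singleton v) p d x (unitMG K v))) x
  ⊚-unitʳ {V} ∗ v p d σ σv≡∗ σ≗id x g = begin
    coeffᴱ V (relabel σ (x ⊚ unitMG K v)) h
      ≡⟨ coeffᴱ-relabel σ (x ⊚ unitMG K v) h ⟩
    _ ≈⟨ ∑-insertion ∗ p d x (unitMG K v) (λ k es → when (sameMG (relabelEdges (to σ) es) h) k) ⟩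
    ∑ x (λ s → ∑ (substitutions o (edgesOf s)) (ψ s) + 0#)
      ≈⟨ ∑-cong x (λ s → trans (+-identityʳ _)
           (trans (∑-substitutions-point o (replace ∗ v) o-point (proj₂ (proj₂ s)) (ψ s))
                  (reflexive (P.cong (λ es → when (sameMG es h) (proj₁ s * 1#)) (relabel-back s))))) ⟩
    ∑ x (λ s → when (sameMG (edgesOf s) h) (proj₁ s * 1#))
      ≈⟨ ∑-cong x (λ s → when-cong _ (*-identityʳ _)) ⟩
    coeffᴱ V x h ∎
    where
    open Composite V ∗ (singleton v) p d using (_⊚_; o)
    h = proj₁ g
    ψ : Carrier × MG V → Edges → Carrier
    ψ s r = when (sameMG (relabelEdges (to σ) (r ++ [])) h) (proj₁ s * 1#)
    o-point : ∀ {a} → a ∈ˢ V → ∀ (χ : ℕ → Carrier) → ∑ (o a) χ ≈ χ (replace ∗ v a)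
    o-point {a} _ χ with a ≟ ∗
    ... | yes _ = +-identityʳ _
    ... | no _  = +-identityʳ _
    σ∘replace≗id : ∀ {a} → a ∈ˢ V → to σ (replace ∗ v a) ≡ a
    σ∘replace≗id {a} a∈ with a ≟ ∗
    ... | yes P.refl = σv≡∗
    ... | no a≢∗ = σ≗id a∈ a≢∗
    relabel-back : ∀ s → relabelEdges (to σ) (relabelEdges (replace ∗ v) (edgesOf s) ++ []) ≡ edgesOf s
    relabel-back s = P.trans (P.cong (relabelEdges (to σ)) (++-identityʳ _))
      (P.trans (relabelEdges-∘ (replace ∗ v) (to σ) (edgesOf s)) (relabelEdges-id σ∘replace≗id (proj₂ (proj₂ s))))

  module _ {V₁ V₂ V₃ : FinSet} {∗₁ ∗₂ : ℕ} (p₁ : ∗₁ ∈ˢ V₁) (p₂ : ∗₂ ∈ˢ V₂)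
           (d₁₂ : Disjoint (elems V₁) (elems V₂)) (d₂₃ : Disjoint (elems V₂) (elems V₃))
           (p₂′ : ∗₂ ∈ˢ graft V₁ ∗₁ V₂ d₁₂)
           (dL : Disjoint (elems (graft V₁ ∗₁ V₂ d₁₂)) (elems V₃))
           (dR : Disjoint (elems V₁) (elems (graft V₂ ∗₂ V₃ d₂₃))) where
    open Composite V₁ ∗₁ V₂ p₁ d₁₂ using () renaming (_⊚_ to _⊚₁₂_; o to o₁; W to V₁₂)
    open Composite V₁₂ ∗₂ V₃ p₂′ dL using () renaming (_⊚_ to _⊚L_; W to WL)
    open Composite V₂ ∗₂ V₃ p₂ d₂₃ using () renaming (_⊚_ to _⊚₂₃_; o to o₂; W to V₂₃)
    open Composite V₁ ∗₁ V₂₃ p₁ dR using () renaming (_⊚_ to _⊚R_; o to o₁₂; W to WR)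

    -- Substituting V₂ for ∗₁ and then V₃ for ∗₂ is substituting (V₂ ∖ ∗₂) ++ V₃ for ∗₁.
    ∑-targets-sequential : ∀ {a} → a ∈ˢ V₁ → ∀ (ψ : ℕ → Carrier) → ∑ (o₁ a) (λ b → ∑ (o₂ b) ψ) ≈ ∑ (o₁₂ a) ψ
    ∑-targets-sequential {a} a∈ ψ with a ≟ ∗₁
    ... | yes P.refl = ∑-targets-unique ∗₂ (elems V₃) (elems V₂) (unique V₂) p₂ ψ
    ... | no _ = trans (+-congʳ (reflexive (P.cong (λ L → ∑ L ψ)
                   (targets-≢ (elems V₃) (λ a≡∗₂ → d₁₂ (a∈ , P.subst (_∈ˢ V₂) (P.sym a≡∗₂) p₂))))))
                 (+-identityʳ _)

    ∑-substitutions-sequential : ∀ S T → EdgesIn (_∈ˢ V₁) S → ∀ (φ : Edges → Carrier) →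
      ∑ (substitutions o₁ S) (λ r → ∑ (substitutions o₂ (r ++ T)) φ) ≈
      ∑ (substitutions o₂ T) (λ q → ∑ (substitutions o₁₂ S) (λ r → φ (r ++ q)))
    ∑-substitutions-sequential S T ps φ = begin
      ∑ (substitutions o₁ S) (λ r → ∑ (substitutions o₂ (r ++ T)) φ)
        ≈⟨ ∑-cong (substitutions o₁ S) (λ r → ∑-substitutions-++ o₂ r T φ) ⟩
      ∑ (substitutions o₁ S) (λ r → ∑ (substitutions o₂ r) (λ r′ → ∑ (substitutions o₂ T) (λ q → φ (r′ ++ q))))
        ≈⟨ ∑-substitutions-∘ o₁ o₂ o₁₂ ∑-targets-sequential ps _ ⟩
      ∑ (substitutions o₁₂ S) (λ r → ∑ (substitutions o₂ T) (λ q → φ (r ++ q)))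
        ≈⟨ ∑-comm (substitutions o₁₂ S) (substitutions o₂ T) _ ⟩
      ∑ (substitutions o₂ T) (λ q → ∑ (substitutions o₁₂ S) (λ r → φ (r ++ q))) ∎

    ⊚-assoc-seq : ∀ (σ : Bij WL WR) → (∀ {v} → v ∈ˢ WL → to σ v ≡ v) → ∀ x y z →
                  _≈ᴷ_ {WR} (relabel σ ((x ⊚₁₂ y) ⊚L z)) (x ⊚R (y ⊚₂₃ z))
    ⊚-assoc-seq σ σ≗id x y z g = begin
      coeffᴱ WR (relabel σ ((x ⊚₁₂ y) ⊚L z)) h
        ≈⟨ coeffᴱ-relabel-id σ σ≗id ((x ⊚₁₂ y) ⊚L z) h ⟩
      coeffᴱ WL ((x ⊚₁₂ y) ⊚L z) h
        ≈⟨ Iterated.coeffᴱ-⊚⊚ V₁ ∗₁ V₂ p₁ d₁₂ ∗₂ V₃ p₂′ dL x y z h ⟩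
      ∑ x (λ s → ∑ y (λ t → ∑ (substitutions o₁ (edgesOf s)) (λ r → ∑ z (λ u →
        ∑ (substitutions o₂ (r ++ edgesOf t)) (λ r′ → when (sameMG (r′ ++ edgesOf u) h) ((proj₁ s * proj₁ t) * proj₁ u))))))
        ≈⟨ ∑-cong x (λ s → ∑-cong y (λ t → reassociate s t)) ⟩
      ∑ x (λ s → ∑ y (λ t → ∑ z (λ u → ∑ (substitutions o₂ (edgesOf t)) (λ q → ∑ (substitutions o₁₂ (edgesOf s)) (λ r →
        when (sameMG (r ++ (q ++ edgesOf u)) h) (proj₁ s * (proj₁ t * proj₁ u)))))))
        ≈⟨ ∑-cong x (λ s → ∑-insertion ∗₂ p₂ d₂₃ y z (λ k es → ∑ (substitutions o₁₂ (edgesOf s)) (λ r →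
             when (sameMG (r ++ es) h) (proj₁ s * k)))) ⟨
      ∑ x (λ s → ∑ (y ⊚₂₃ z) (λ w → ∑ (substitutions o₁₂ (edgesOf s)) (λ r →
        when (sameMG (r ++ edgesOf w) h) (proj₁ s * proj₁ w))))
        ≈⟨ ∑-insertion ∗₁ p₁ dR x (y ⊚₂₃ z) (λ k es → when (sameMG es h) k) ⟨
      coeffᴱ WR (x ⊚R (y ⊚₂₃ z)) h ∎
      where
      h = proj₁ g
      reassociate : ∀ (s : Carrier × MG V₁) (t : Carrier × MG V₂) →
        ∑ (substitutions o₁ (edgesOf s)) (λ r → ∑ z (λ u → ∑ (substitutions o₂ (r ++ edgesOf t)) (λ r′ →
          when (sameMG (r′ ++ edgesOf u) h) ((proj₁ s * proj₁ t) * proj₁ u)))) ≈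
        ∑ z (λ u → ∑ (substitutions o₂ (edgesOf t)) (λ q → ∑ (substitutions o₁₂ (edgesOf s)) (λ r →
          when (sameMG (r ++ (q ++ edgesOf u)) h) (proj₁ s * (proj₁ t * proj₁ u)))))
      reassociate s t = trans (∑-comm (substitutions o₁ (edgesOf s)) z _) (∑-cong z (λ u →
        trans (∑-substitutions-sequential (edgesOf s) (edgesOf t) (proj₂ (proj₂ s)) _)
              (∑-cong (substitutions o₂ (edgesOf t)) (λ q → ∑-cong (substitutions o₁₂ (edgesOf s)) (λ r →
                 trans (reflexive (P.cong (λ es → when (sameMG es h) ((proj₁ s * proj₁ t) * proj₁ u))
                                          (++-assoc r q (edgesOf u))))
                       (when-cong _ (*-assoc _ _ _)))))))

  -- A second substitution that fixes every vertex of T only acts on the first part of r ++ T.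
  ∑-substitutions-fixing : ∀ {p q} {P : ℕ → Set p} {Q : ℕ → Set q} (oA oB : ℕ → List ℕ) →
    (∀ {a} → Q a → ∀ (ψ : ℕ → Carrier) → ∑ (oB a) ψ ≈ ψ a) →
    ∀ {S T} → EdgesIn P S → EdgesIn Q T → ∀ (φ : Edges → Carrier) →
    ∑ (substitutions oA S) (λ r → ∑ (substitutions oB (r ++ T)) φ) ≈
    ∑ (substitutions (concatMap oB ∘ oA) S) (λ r → φ (r ++ T))
  ∑-substitutions-fixing {P = P} oA oB oB-fixes {S} {T} ps qs φ = begin
    ∑ (substitutions oA S) (λ r → ∑ (substitutions oB (r ++ T)) φ)
      ≈⟨ ∑-cong (substitutions oA S) (λ r → ∑-substitutions-++ oB r T φ) ⟩
    ∑ (substitutions oA S) (λ r → ∑ (substitutions oB r) (λ r′ → ∑ (substitutions oB T) (λ q → φ (r′ ++ q))))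
      ≈⟨ ∑-cong (substitutions oA S) (λ r → ∑-cong (substitutions oB r) (λ r′ →
           trans (∑-substitutions-point oB id oB-fixes qs _)
                 (reflexive (P.cong (λ q → φ (r′ ++ q)) (relabelEdges-id (λ _ → P.refl) qs))))) ⟩
    ∑ (substitutions oA S) (λ r → ∑ (substitutions oB r) (λ r′ → φ (r′ ++ T)))
      ≈⟨ ∑-substitutions-∘ {Pr = P} oA oB (concatMap oB ∘ oA) (λ {a} _ ψ → sym (∑-concatMap oB (oA a) ψ)) ps _ ⟩
    ∑ (substitutions (concatMap oB ∘ oA) S) (λ r → φ (r ++ T)) ∎

  module _ {V₁ V₂ V₃ : FinSet} {∗₁ ∗₂ : ℕ} (∗₁≢∗₂ : ∗₁ ≢ ∗₂) (p₁ : ∗₁ ∈ˢ V₁) (p₂ : ∗₂ ∈ˢ V₁)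
           (d₁₂ : Disjoint (elems V₁) (elems V₂)) (d₁₃ : Disjoint (elems V₁) (elems V₃))
           (p₂′ : ∗₂ ∈ˢ graft V₁ ∗₁ V₂ d₁₂) (p₁′ : ∗₁ ∈ˢ graft V₁ ∗₂ V₃ d₁₃)
           (dL : Disjoint (elems (graft V₁ ∗₁ V₂ d₁₂)) (elems V₃))
           (dR : Disjoint (elems (graft V₁ ∗₂ V₃ d₁₃)) (elems V₂)) where
    open Composite V₁ ∗₁ V₂ p₁ d₁₂ using () renaming (_⊚_ to _⊚₁₂_; o to o₁; W to V₁₂)
    open Composite V₁₂ ∗₂ V₃ p₂′ dL using () renaming (_⊚_ to _⊚L_; W to WL)
    open Composite V₁ ∗₂ V₃ p₂ d₁₃ using () renaming (_⊚_ to _⊚₁₃_; o to o₂; W to V₁₃)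
    open Composite V₁₃ ∗₁ V₂ p₁′ dR using () renaming (_⊚_ to _⊚R_; W to WR)

    o₂-fixes-V₂ : ∀ {a} → a ∈ˢ V₂ → ∀ (ψ : ℕ → Carrier) → ∑ (o₂ a) ψ ≈ ψ a
    o₂-fixes-V₂ a∈ ψ = trans (reflexive (P.cong (λ L → ∑ L ψ)
      (targets-≢ (elems V₃) (λ a≡∗₂ → d₁₂ (P.subst (_∈ˢ V₁) (P.sym a≡∗₂) p₂ , a∈))))) (+-identityʳ _)

    o₁-fixes-V₃ : ∀ {a} → a ∈ˢ V₃ → ∀ (ψ : ℕ → Carrier) → ∑ (o₁ a) ψ ≈ ψ a
    o₁-fixes-V₃ a∈ ψ = trans (reflexive (P.cong (λ L → ∑ L ψ)
      (targets-≢ (elems V₂) (λ a≡∗₁ → d₁₃ (P.subst (_∈ˢ V₁) (P.sym a≡∗₁) p₁ , a∈))))) (+-identityʳ _)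

    ∑-targets-parallel : ∀ {a} → a ∈ˢ V₁ → ∀ (ψ : ℕ → Carrier) →
                         ∑ (concatMap o₂ (o₁ a)) ψ ≈ ∑ (concatMap o₁ (o₂ a)) ψ
    ∑-targets-parallel {a} a∈ ψ = trans (∑-concatMap o₂ (o₁ a) ψ) (trans swap (sym (∑-concatMap o₁ (o₂ a) ψ)))
      where
      ∗₂∉V₂ : ∗₂ ∉ elems V₂
      ∗₂∉V₂ ∗₂∈ = d₁₂ (p₂ , ∗₂∈)
      ∗₁∉V₃ : ∗₁ ∉ elems V₃
      ∗₁∉V₃ ∗₁∈ = d₁₃ (p₁ , ∗₁∈)
      swap : ∑ (o₁ a) (λ b → ∑ (o₂ b) ψ) ≈ ∑ (o₂ a) (λ b → ∑ (o₁ b) ψ)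
      swap with a ≟ ∗₁ | a ≟ ∗₂
      ... | yes P.refl | yes a≡∗₂ = ⊥-elim (∗₁≢∗₂ a≡∗₂)
      ... | yes P.refl | no _ = trans (∑-targets-absent ∗₂ (elems V₃) (elems V₂) ∗₂∉V₂ ψ)
          (sym (trans (+-identityʳ _) (reflexive (P.cong (λ L → ∑ L ψ) (targets-∗ ∗₁ (elems V₂))))))
      ... | no _ | yes P.refl = trans (trans (+-identityʳ _) (reflexive (P.cong (λ L → ∑ L ψ) (targets-∗ ∗₂ (elems V₃)))))
          (sym (∑-targets-absent ∗₁ (elems V₂) (elems V₃) ∗₁∉V₃ ψ))
      ... | no a≢∗₁ | no a≢∗₂ = +-congʳ (trans (reflexive (P.cong (λ L → ∑ L ψ) (targets-≢ (elems V₃) a≢∗₂)))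
                                              (sym (reflexive (P.cong (λ L → ∑ L ψ) (targets-≢ (elems V₂) a≢∗₁)))))

    ⊚-assoc-par : ∀ (σ : Bij WL WR) → (∀ {v} → v ∈ˢ WL → to σ v ≡ v) → ∀ x y z →
                  _≈ᴷ_ {WR} (relabel σ ((x ⊚₁₂ y) ⊚L z)) ((x ⊚₁₃ z) ⊚R y)
    ⊚-assoc-par σ σ≗id x y z g = begin
      coeffᴱ WR (relabel σ ((x ⊚₁₂ y) ⊚L z)) h
        ≈⟨ coeffᴱ-relabel-id σ σ≗id ((x ⊚₁₂ y) ⊚L z) h ⟩
      coeffᴱ WL ((x ⊚₁₂ y) ⊚L z) h
        ≈⟨ Iterated.coeffᴱ-⊚⊚ V₁ ∗₁ V₂ p₁ d₁₂ ∗₂ V₃ p₂′ dL x y z h ⟩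
      ∑ x (λ s → ∑ y (λ t → ∑ (substitutions o₁ (edgesOf s)) (λ r → ∑ z (λ u →
        ∑ (substitutions o₂ (r ++ edgesOf t)) (λ r′ → when (sameMG (r′ ++ edgesOf u) h) ((proj₁ s * proj₁ t) * proj₁ u))))))
        ≈⟨ ∑-cong x (λ s → ∑-cong y (λ t → trans (∑-comm (substitutions o₁ (edgesOf s)) z _) (∑-cong z (λ u →
             ∑-substitutions-fixing o₁ o₂ o₂-fixes-V₂ (proj₂ (proj₂ s)) (proj₂ (proj₂ t)) _)))) ⟩
      ∑ x (λ s → ∑ y (λ t → ∑ z (λ u → ∑ (substitutions (concatMap o₂ ∘ o₁) (edgesOf s)) (λ r →
        when (sameMG ((r ++ edgesOf t) ++ edgesOf u) h) ((proj₁ s * proj₁ t) * proj₁ u)))))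
        ≈⟨ ∑-cong x (λ s → ∑-cong y (λ t → ∑-cong z (λ u →
             trans (∑-substitutions-cong _ _ ∑-targets-parallel (proj₂ (proj₂ s)) _)
                   (∑-cong (substitutions (concatMap o₁ ∘ o₂) (edgesOf s)) (λ r → exchange r s t u))))) ⟩
      ∑ x (λ s → ∑ y (λ t → ∑ z (λ u → ∑ (substitutions (concatMap o₁ ∘ o₂) (edgesOf s)) (λ r →
        when (sameMG ((r ++ edgesOf u) ++ edgesOf t) h) ((proj₁ s * proj₁ u) * proj₁ t)))))
        ≈⟨ ∑-cong x (λ s → ∑-comm y z _) ⟩
      ∑ x (λ s → ∑ z (λ u → ∑ y (λ t → ∑ (substitutions (concatMap o₁ ∘ o₂) (edgesOf s)) (λ r →
        when (sameMG ((r ++ edgesOf u) ++ edgesOf t) h) ((proj₁ s * proj₁ u) * proj₁ t)))))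
        ≈⟨ ∑-cong x (λ s → ∑-cong z (λ u → trans (∑-comm (substitutions o₂ (edgesOf s)) y _) (∑-cong y (λ t →
             ∑-substitutions-fixing o₂ o₁ o₁-fixes-V₃ (proj₂ (proj₂ s)) (proj₂ (proj₂ u)) _)))) ⟨
      ∑ x (λ s → ∑ z (λ u → ∑ (substitutions o₂ (edgesOf s)) (λ r → ∑ y (λ t →
        ∑ (substitutions o₁ (r ++ edgesOf u)) (λ r′ → when (sameMG (r′ ++ edgesOf t) h) ((proj₁ s * proj₁ u) * proj₁ t))))))
        ≈⟨ Iterated.coeffᴱ-⊚⊚ V₁ ∗₂ V₃ p₂ d₁₃ ∗₁ V₂ p₁′ dR x z y h ⟨
      coeffᴱ WR ((x ⊚₁₃ z) ⊚R y) h ∎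
      where
      h = proj₁ g
      exchange : ∀ r (s : Carrier × MG V₁) (t : Carrier × MG V₂) (u : Carrier × MG V₃) →
        when (sameMG ((r ++ edgesOf t) ++ edgesOf u) h) ((proj₁ s * proj₁ t) * proj₁ u) ≈
        when (sameMG ((r ++ edgesOf u) ++ edgesOf t) h) ((proj₁ s * proj₁ u) * proj₁ t)
      exchange r s t u = trans
        (reflexive (P.cong (λ b → when b ((proj₁ s * proj₁ t) * proj₁ u)) (sameMG-respˡ swapped h)))
        (when-cong _ (xy∙z≈xz∙y _ _ _))
        where
        swapped : ((r ++ edgesOf t) ++ edgesOf u) ≋ ((r ++ edgesOf u) ++ edgesOf t)
        swapped = P.subst₂ _≋_ (P.sym (++-assoc r (edgesOf t) (edgesOf u))) (P.sym (++-assoc r (edgesOf u) (edgesOf t)))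
                    (≋-++ˡ r (↭⇒≋ (++-comm (edgesOf t) (edgesOf u))))

-- The last argument of IsOperad is insertionMG K with its definition unfolded.
mainTheorem1 : ∀ {c ℓ} (K : Field c ℓ) → CharacteristicZero K →
    IsOperad (KMG K) (unitMG K) (λ {V₁} {V₂} ∗ _ d x y → concatMap (λ s → concatMap (λ t →
        map (λ g → Field._*_ K (proj₁ s) (proj₁ t) , g) (Insertion.insert V₁ ∗ V₂ d (proj₂ s) (proj₂ t))) y) x)
mainTheorem1 K _ = record
  { isLinearSpecies  = isLinearSpecies
  ; comp-cong        = λ p d {x} {x′} {y} {y′} → ⊚-cong _ _ _ p d {x} {x′} {y} {y′}
  ; comp-+ˡ          = λ p d → ⊚-+ˡ _ _ _ p d
  ; comp-+ʳ          = λ p d → ⊚-+ʳ _ _ _ p d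
  ; comp-·ˡ          = λ p d → ⊚-·ˡ _ _ _ p d
  ; comp-·ʳ          = λ p d → ⊚-·ʳ _ _ _ p d
  ; comp-equivariant = ⊚-relabel
  ; assoc-seq        = ⊚-assoc-seq
  ; assoc-par        = ⊚-assoc-par
  ; unitˡ            = ⊚-unitˡ
  ; unitʳ            = ⊚-unitʳ
  }
  where
  open Coefficients K
  open Operad K
  open Composite
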